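{- Let $G=(V,E)$ be a graph with at least two vertices and no isolated vertices, let $E$ also denote its graph CNF $\bigwedge_{\{x,y\}\in E}(x\vee y)$, and let $D$ be a DNNF equivalent to $E$. Then there exists a nice DNNF $D'$ equivalent to $D$ such that $\mathsf{size}(D')\leq 2\cdot\mathsf{size}(D)$.
   Context: Fix a countable set $X$ of variables (with $V\subseteq X$); an assignment is a function $X\to\{0,1\}$. An NNF is a finite directed acyclic graph whose nodes (gates) are labelled and whose arcs are called wires, with a unique sink (the output gate); source nodes (input gates) are labelled by $0$, $1$, $x$ or $\neg x$ with $x\in X$, non-source nodes by $\wedge$ or $\vee$. $\mathsf{vars}(C)$ is the set of variables in input-gate labels; $\mathsf{size}(C)$ is the number of wires; two NNFs (or an NNF and a CNF) are equivalent if they take the same value under every assignment. For a gate $v$, $\mathsf{sub}(C,v)$ is the NNF consisting of $v$ and all gates with a directed path to $v$. A DNNF is an NNF in which, for every $\wedge$-gate with input wires from $v_1,\dots,v_i$, the sets $\mathsf{vars}(\mathsf{sub}(D,v_j))$ are pairwise disjoint. The fanin of a gate is its number of incoming wires. A DNNF is nice if every gate has fanin at most $2$, no input gate is labelled by a constant, and no input gate is labelled by a negated variable. -}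

module Defs where

open import Data.Nat using (ℕ; zero; suc; _<_; _≤_)
open import Data.Bool using (Bool; true; false; not; _∨_)
open import Data.Fin using (Fin; toℕ; fromℕ; _≟_)
open import Data.List using (List; []; map; filter; length)
open import Data.Bool.ListAction using (all; any)
open import Data.Unit using (⊤)
open import Data.Empty using (⊥)
open import Data.List.Membership.Propositional using (_∈_; _∉_)
open import Data.List.Relation.Unary.All using (All)
open import Data.List.Relation.Unary.Unique.Propositional using (Unique)
open import Data.Product using (_×_; _,_; proj₁; proj₂; ∃; Σ)
open import Data.Sum using (_⊎_)
open import Relation.Binary.PropositionalEquality using (_≡_; _≢_)
open import Relation.Nullary using (¬_)

Var : Set
Var = ℕ

Assignment : Set
Assignment = Var → Bool

data Label : Set where
  const : Bool → Label
  pos   : Var → Label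
  neg   : Var → Label
  and   : Label
  or    : Label

IsInputLabel : Label → Set
IsInputLabel (const _) = ⊤
IsInputLabel (pos _)   = ⊤
IsInputLabel (neg _)   = ⊤
IsInputLabel and       = ⊥
IsInputLabel or        = ⊥

-- Gates are numbered in a
-- topological order (every wire goes from a smaller to a larger index),
-- which represents an arbitrary DAG up to renaming of gates.  A wire is
-- a pair (source , target); there are no parallel wires.  The output
-- gate (unique sink) is the last gate  fromℕ n.
record NNF : Set where
  field
    n      : ℕ
    label  : Fin (suc n) → Label
    wires  : List (Fin (suc n) × Fin (suc n))
    wires-unique : Unique wires
    wires-topo   : All (λ w → toℕ (proj₁ w) < toℕ (proj₂ w)) wires
    input-source   : ∀ v → IsInputLabel (label v) → ∀ u → (u , v) ∉ wires
    noninput-wired : ∀ v → ¬ IsInputLabel (label v) → ∃ λ u → (u , v) ∈ wires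
    unique-sink    : ∀ v → v ≢ fromℕ n → ∃ λ w → (v , w) ∈ wires

  Gate : Set
  Gate = Fin (suc n)

  output : Gate
  output = fromℕ n

  preds : Gate → List Gate
  preds v = map proj₁ (filter (λ w → proj₂ w ≟ v) wires)

  fanin : Gate → ℕ
  fanin v = length (preds v)

  -- value of a gate, computed with a fuel bound; since every path has at
  -- most (suc n) gates, fuel (suc n) gives the true value.
  evalFuel : ℕ → Assignment → Gate → Bool
  evalFuel zero    a v = false
  evalFuel (suc k) a v with label v
  ... | const b = b
  ... | pos x   = a x
  ... | neg x   = not (a x)
  ... | and     = all (evalFuel k a) (preds v)
  ... | or      = any (evalFuel k a) (preds v)

  eval : Assignment → Bool
  eval a = evalFuel (suc n) a output

  data Reach : Gate → Gate → Set where
    here : ∀ {v} → Reach v v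
    step : ∀ {u w v} → (u , w) ∈ wires → Reach w v → Reach u v

  InVarsSub : Gate → Var → Set
  InVarsSub v x = ∃ λ u → Reach u v × (label u ≡ pos x ⊎ label u ≡ neg x)

open NNF public

size : NNF → ℕ
size C = length (wires C)

Equivalent : NNF → NNF → Set
Equivalent C D = ∀ (a : Assignment) → eval C a ≡ eval D a

IsDNNF : NNF → Set
IsDNNF C = ∀ v → label C v ≡ and →
           ∀ u₁ u₂ → (u₁ , v) ∈ wires C → (u₂ , v) ∈ wires C → u₁ ≢ u₂ →
           ∀ x → InVarsSub C u₁ x → ¬ InVarsSub C u₂ x

IsNice : NNF → Set
IsNice C = IsDNNF C
         × (∀ v → fanin C v ≤ 2)
         × (∀ v b → label C v ≢ const b)
         × (∀ v x → label C v ≢ neg x)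

-- A finite (simple, undirected) graph on vertices V ⊆ X; an edge {x,y}
-- is stored as an ordered pair (x , y) with x ≠ y.
record Graph : Set where
  field
    V : List Var
    E : List (Var × Var)
    V-unique : Unique V
    E-in-V   : All (λ e → proj₁ e ∈ V × proj₂ e ∈ V) E
    loopless : All (λ e → proj₁ e ≢ proj₂ e) E

open Graph public

evalGraphCNF : Graph → Assignment → Bool
evalGraphCNF G a = all (λ e → a (proj₁ e) ∨ a (proj₂ e)) (E G)

EquivalentCNF : NNF → Graph → Set
EquivalentCNF C G = ∀ (a : Assignment) → eval C a ≡ evalGraphCNF G a

NoIsolated : Graph → Set
NoIsolated G = ∀ v → v ∈ V G → ∃ λ e → e ∈ E G × (v ≡ proj₁ e ⊎ v ≡ proj₂ e)

module Submission where

-- Negative literals can be replaced by the constant 1: D computes a monotone function, and every assignment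
-- satisfying the new circuit D⁺ lies above one satisfying D, built gate by gate (an ∨-gate follows a satisfied
-- input, an ∧-gate takes the meet of its inputs' witnesses, which decomposability makes compatible).
-- In the negation-free D⁺ a constant input of a non-constant ∧-gate is 1 and of an ∨-gate is 0, so it can be
-- dropped. A non-constant gate v with remaining ("essential") inputs c₀ … c_{k-1} becomes a chain of slots,
-- slot j computing the junction of c₀ … c_j from slot j - 1 and the last slot of c_j; only the gates joined to
-- the output through non-constant gates are kept. Every new wire is either a chain wire or a copy of a wire
-- c_j → v, and each kind maps injectively into the wires of D, whence size ≤ 2 · size D. The graph
-- hypotheses make the output non-constant: all-true satisfies the CNF and all-false falsifies some edge.

open import Data.Bool using (Bool; true; false; not; _∧_; _∨_; if_then_else_)
import Data.Bool as Bool
open import Data.Bool.ListAction using (all; any)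
import Data.Bool.ListAction as ListAction
open import Data.Bool.Properties using (T-≡; ∧-assoc; ∨-assoc; ∧-inverseʳ)
open import Data.Empty using (⊥; ⊥-elim)
open import Data.Fin using (Fin; toℕ; fromℕ; fromℕ<; _≟_)
open import Data.Fin.Properties using (toℕ-fromℕ; toℕ-fromℕ<; toℕ≤pred[n]; toℕ-injective; toℕ<n)
open import Data.List using (List; []; _∷_; _++_; map; filter; length; take; upTo; allFin; cartesianProduct)
open import Data.List.Properties using (map-cong-local; length-map; length-filter; take-all)
open import Data.List.Membership.Propositional using (_∈_; _∉_; find; lose)
open import Data.List.Membership.Propositional.Properties
  using (∈-map⁻; ∈-map⁺; ∈-filter⁻; ∈-filter⁺; ∈-upTo⁺; ∈-allFin; ∈-cartesianProduct⁺)
open import Data.List.Relation.Binary.Subset.Propositional using (_⊆_)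
import Data.List.Relation.Binary.Subset.Propositional.Properties as Subset
import Data.List.Relation.Unary.All as All
open import Data.List.Relation.Unary.All.Properties using (all⁺; all⁻; all-anti-mono)
open import Data.List.Relation.Unary.AllPairs using (AllPairs; []; _∷_)
import Data.List.Relation.Unary.AllPairs.Properties as AllPairs
open import Data.List.Relation.Unary.Any using (here; there)
open import Data.List.Relation.Unary.Any.Properties using (any⁺; any⁻)
open import Data.List.Relation.Unary.Unique.Propositional using (Unique)
import Data.List.Relation.Unary.Unique.Propositional.Properties as Unique
open import Data.Maybe using (Maybe; just; nothing)
import Data.Maybe as Maybe
open import Data.Maybe.Properties using (just-injective) renaming (≡-dec to ≡-dec-Maybe)
open import Data.Nat using (ℕ; zero; suc; pred; _<_; _≤_; _+_; _*_; _∸_; z≤n; s≤s; >-nonZero)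
open import Data.Nat.DivMod using (_/_; _%_; m%n<n; m≡m%n+[m/n]*n; m<n*o⇒m/o<n)
import Data.Nat.Properties as ℕ
open import Data.Product using (_×_; _,_; proj₁; proj₂; ∃)
open import Data.Sum using (_⊎_; inj₁; inj₂)
open import Data.Unit using (tt)
open import Function.Base using (_∘_)
open import Function.Bundles using (Equivalence)
open import Relation.Binary.Definitions using (tri<; tri≈; tri>)
open import Relation.Binary.PropositionalEquality
  using (_≡_; _≢_; refl; sym; trans; cong; cong₂; subst; subst₂; module ≡-Reasoning)
open import Relation.Nullary using (¬_; ¬?; Dec; yes; no; does)
open import Relation.Nullary.Decidable using (_×-dec_; _⊎-dec_)

open import Defs

open Equivalence using (to; from)

true⇔true⇒≡ : ∀ {b c} → (b ≡ true → c ≡ true) → (c ≡ true → b ≡ true) → b ≡ c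
true⇔true⇒≡ {true}  {true}  _ _ = refl
true⇔true⇒≡ {true}  {false} f _ = sym (f refl)
true⇔true⇒≡ {false} {true}  _ g = g refl
true⇔true⇒≡ {false} {false} _ _ = refl

∧-true⁻ˡ : ∀ {b c} → b ∧ c ≡ true → b ≡ true
∧-true⁻ˡ {true} _ = refl

∧-true⁻ʳ : ∀ {b c} → b ∧ c ≡ true → c ≡ true
∧-true⁻ʳ {true} e = e

∧-true⁺ : ∀ {b c} → b ≡ true → c ≡ true → b ∧ c ≡ true
∧-true⁺ refl refl = refl

module _ {A : Set} (f : A → Bool) where

  all-true⁻ : ∀ {xs x} → all f xs ≡ true → x ∈ xs → f x ≡ true
  all-true⁻ e x∈xs = to T-≡ (All.lookup (all⁺ f _ (from T-≡ e)) x∈xs)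

  all-true⁺ : ∀ xs → (∀ {x} → x ∈ xs → f x ≡ true) → all f xs ≡ true
  all-true⁺ xs h = to T-≡ (all⁻ f (All.tabulate λ m → from T-≡ (h m)))

  any-true⁻ : ∀ xs → any f xs ≡ true → ∃ λ x → x ∈ xs × f x ≡ true
  any-true⁻ xs e with find (any⁻ f xs (from T-≡ e))
  ... | x , x∈xs , fx = x , x∈xs , to T-≡ fx

  any-true⁺ : ∀ {xs x} → x ∈ xs → f x ≡ true → any f xs ≡ true
  any-true⁺ x∈xs fx = to T-≡ (any⁺ f (lose x∈xs (from T-≡ fx)))

nth : List ℕ → ℕ → ℕ
nth []       i       = 0
nth (x ∷ xs) zero    = x
nth (x ∷ xs) (suc i) = nth xs i

nth-∈ : ∀ xs {i} → i < length xs → nth xs i ∈ xs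
nth-∈ (x ∷ xs) {zero}  _         = here refl
nth-∈ (x ∷ xs) {suc i} (s≤s i<n) = there (nth-∈ xs i<n)

∈⇒nth : ∀ {xs x} → x ∈ xs → ∃ λ i → i < length xs × nth xs i ≡ x
∈⇒nth (here refl) = 0 , s≤s z≤n , refl
∈⇒nth (there x∈xs) with ∈⇒nth x∈xs
... | i , i<n , e = suc i , s≤s i<n , e

nth-strictMono : ∀ {xs i j} → AllPairs _<_ xs → i < j → j < length xs → nth xs i < nth xs j
nth-strictMono {x ∷ xs} {zero}  {suc j} (x< ∷ _) _ (s≤s j<n) = All.lookup x< (nth-∈ xs j<n)
nth-strictMono {x ∷ xs} {suc i} {suc j} (_ ∷ sorted) (s≤s i<j) (s≤s j<n) = nth-strictMono sorted i<j j<n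

lookup? : ∀ {A : Set} → List A → ℕ → Maybe A
lookup? []       _       = nothing
lookup? (x ∷ xs) zero    = just x
lookup? (x ∷ xs) (suc i) = lookup? xs i

lookup?-∈ : ∀ {A : Set} (xs : List A) {i x} → lookup? xs i ≡ just x → x ∈ xs
lookup?-∈ (x ∷ xs) {zero}  refl = here refl
lookup?-∈ (x ∷ xs) {suc i} e    = there (lookup?-∈ xs e)

lookup?-< : ∀ {A : Set} (xs : List A) {i x} → lookup? xs i ≡ just x → i < length xs
lookup?-< (x ∷ xs) {zero}  _ = s≤s z≤n
lookup?-< (x ∷ xs) {suc i} e = s≤s (lookup?-< xs e)

<⇒lookup? : ∀ {A : Set} (xs : List A) {i} → i < length xs → ∃ λ x → lookup? xs i ≡ just x
<⇒lookup? (x ∷ xs) {zero}  _         = x , refl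
<⇒lookup? (x ∷ xs) {suc i} (s≤s i<n) = <⇒lookup? xs i<n

∈⇒lookup? : ∀ {A : Set} {xs : List A} {x} → x ∈ xs → ∃ λ i → lookup? xs i ≡ just x
∈⇒lookup? (here refl)  = 0 , refl
∈⇒lookup? (there x∈xs) with ∈⇒lookup? x∈xs
... | i , e = suc i , e

lookup?-injective : ∀ {A : Set} {xs : List A} {i j x} → Unique xs →
                    lookup? xs i ≡ just x → lookup? xs j ≡ just x → i ≡ j
lookup?-injective {xs = x ∷ xs} {zero}  {zero}  _           _  _  = refl
lookup?-injective {xs = x ∷ xs} {zero}  {suc j} (x∉ ∷ _)    refl e = ⊥-elim (All.lookup x∉ (lookup?-∈ xs e) refl)
lookup?-injective {xs = x ∷ xs} {suc i} {zero}  (x∉ ∷ _)    e refl = ⊥-elim (All.lookup x∉ (lookup?-∈ xs e) refl)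
lookup?-injective {xs = x ∷ xs} {suc i} {suc j} (_ ∷ uniq)  e₁ e₂  = cong suc (lookup?-injective uniq e₁ e₂)

take-suc-lookup? : ∀ {A : Set} (xs : List A) {j x} → lookup? xs j ≡ just x → take (suc j) xs ≡ take j xs ++ x ∷ []
take-suc-lookup? (y ∷ xs) {zero}  refl = refl
take-suc-lookup? (y ∷ xs) {suc j} e    = cong (y ∷_) (take-suc-lookup? xs e)

Unique-map : ∀ {A B : Set} (f : A → B) {xs} → Unique xs →
             (∀ {x y} → x ∈ xs → y ∈ xs → f x ≡ f y → x ≡ y) → Unique (map f xs)
Unique-map f {[]}     []         _   = []
Unique-map f {x ∷ xs} (x∉ ∷ uniq) inj =
  All.tabulate fx≢ ∷ Unique-map f uniq (λ x∈ y∈ → inj (there x∈) (there y∈))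
  where
  fx≢ : ∀ {z} → z ∈ map f xs → f x ≢ z
  fx≢ z∈ fx≡z with ∈-map⁻ f z∈
  ... | y , y∈ , refl = All.lookup x∉ y∈ (inj (here refl) (there y∈) fx≡z)

Unique⇒length≤ : ∀ {A : Set} {xs ys : List A} → Unique xs → xs ⊆ ys → length xs ≤ length ys
Unique⇒length≤ {xs = []}     _           _     = z≤n
Unique⇒length≤ {xs = x ∷ xs} (x∉ ∷ uniq) xs⊆ys with remove (xs⊆ys (here refl))
  where
  remove : ∀ {ys x} → x ∈ ys → ∃ λ ys′ → length ys ≡ suc (length ys′) × (∀ {z} → z ∈ ys → z ≢ x → z ∈ ys′)
  remove {y ∷ ys} (here refl) = ys , refl , λ { (here refl) z≢y → ⊥-elim (z≢y refl) ; (there z∈) _ → z∈ }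
  remove {y ∷ ys} (there x∈)  with remove x∈
  ... | ys′ , len , kept = y ∷ ys′ , cong suc len , λ { (here refl) _ → here refl ; (there z∈) z≢x → there (kept z∈ z≢x) }
... | ys′ , len , kept = subst (suc (length xs) ≤_) (sym len)
  (s≤s (Unique⇒length≤ uniq λ z∈ → kept (xs⊆ys (there z∈)) λ z≡x → All.lookup x∉ z∈ (sym z≡x)))

length≤-by-injection : ∀ {A B : Set} (f : A → B) {xs : List A} {ys : List B} → Unique xs →
                       (∀ {x} → x ∈ xs → f x ∈ ys) → (∀ {x y} → x ∈ xs → y ∈ xs → f x ≡ f y → x ≡ y) →
                       length xs ≤ length ys
length≤-by-injection f {xs} {ys} uniq f∈ inj = subst (_≤ length ys) (length-map f xs)
  (Unique⇒length≤ (Unique-map f uniq inj) λ z∈ → image∈ (∈-map⁻ f z∈))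
  where
  image∈ : ∀ {z} → ∃ (λ x → x ∈ xs × z ≡ f x) → z ∈ ys
  image∈ (x , x∈ , refl) = f∈ x∈

length-filter-∁ : ∀ {A : Set} {P : A → Set} (P? : ∀ x → Dec (P x)) xs →
                  length xs ≡ length (filter P? xs) + length (filter (λ x → ¬? (P? x)) xs)
length-filter-∁ P? []       = refl
length-filter-∁ P? (x ∷ xs) with P? x
... | yes _ = cong suc (length-filter-∁ P? xs)
... | no  _ = trans (cong suc (length-filter-∁ P? xs)) (sym (ℕ.+-suc _ _))

data Junction : Label → Set where
  ∧-gate : Junction and
  ∨-gate : Junction or

isInput? : ∀ l → Dec (IsInputLabel l)
isInput? (const _) = yes tt
isInput? (pos _)   = yes tt
isInput? (neg _)   = yes tt
isInput? and       = no λ ()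
isInput? or        = no λ ()

junction : ∀ l → ¬ IsInputLabel l → Junction l
junction (const _) ¬input = ⊥-elim (¬input tt)
junction (pos _)   ¬input = ⊥-elim (¬input tt)
junction (neg _)   ¬input = ⊥-elim (¬input tt)
junction and       _      = ∧-gate
junction or        _      = ∨-gate

Junction⇒¬input : ∀ {l} → Junction l → ¬ IsInputLabel l
Junction⇒¬input ∧-gate ()
Junction⇒¬input ∨-gate ()

neutral : ∀ {l} → Junction l → Bool
neutral ∧-gate = true
neutral ∨-gate = false

combine : ∀ {l} → Junction l → Bool → Bool → Bool
combine ∧-gate = _∧_
combine ∨-gate = _∨_

fold : ∀ {l} {A : Set} → Junction l → (A → Bool) → List A → Bool
fold ∧-gate = all
fold ∨-gate = any

fold-[] : ∀ {l} (J : Junction l) {A : Set} (f : A → Bool) → fold J f [] ≡ neutral J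
fold-[] ∧-gate f = refl
fold-[] ∨-gate f = refl

fold-∷ : ∀ {l} (J : Junction l) {A : Set} (f : A → Bool) x xs →
         fold J f (x ∷ xs) ≡ combine J (f x) (fold J f xs)
fold-∷ ∧-gate f x xs = refl
fold-∷ ∨-gate f x xs = refl

combine-neutralˡ : ∀ {l} (J : Junction l) b → combine J (neutral J) b ≡ b
combine-neutralˡ ∧-gate b = refl
combine-neutralˡ ∨-gate b = refl

combine-assoc : ∀ {l} (J : Junction l) a b c →
                combine J (combine J a b) c ≡ combine J a (combine J b c)
combine-assoc ∧-gate = ∧-assoc
combine-assoc ∨-gate = ∨-assoc

neutral-or-absorbing : ∀ {l} (J : Junction l) b → b ≡ neutral J ⊎ b ≡ not (neutral J)
neutral-or-absorbing ∧-gate true  = inj₁ refl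
neutral-or-absorbing ∧-gate false = inj₂ refl
neutral-or-absorbing ∨-gate true  = inj₂ refl
neutral-or-absorbing ∨-gate false = inj₁ refl

fold-singleton-cong : ∀ {l} (J : Junction l) {A B : Set} {f : A → Bool} {g : B → Bool} {x y} →
                      f x ≡ g y → fold J f (x ∷ []) ≡ fold J g (y ∷ [])
fold-singleton-cong ∧-gate e = cong (_∧ true) e
fold-singleton-cong ∨-gate e = cong (_∨ false) e

fold-++ : ∀ {l} (J : Junction l) {A : Set} (f : A → Bool) xs ys →
          fold J f (xs ++ ys) ≡ combine J (fold J f xs) (fold J f ys)
fold-++ ∧-gate f [] ys = refl
fold-++ ∨-gate f [] ys = refl
fold-++ J f (x ∷ xs) ys = begin
  fold J f (x ∷ xs ++ ys)                                 ≡⟨ fold-∷ J f x (xs ++ ys) ⟩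
  combine J (f x) (fold J f (xs ++ ys))                   ≡⟨ cong (combine J (f x)) (fold-++ J f xs ys) ⟩
  combine J (f x) (combine J (fold J f xs) (fold J f ys)) ≡⟨ combine-assoc J _ _ _ ⟨
  combine J (combine J (f x) (fold J f xs)) (fold J f ys) ≡⟨ cong (λ b → combine J b _) (fold-∷ J f x xs) ⟨
  combine J (fold J f (x ∷ xs)) (fold J f ys)             ∎
  where open ≡-Reasoning

fold-cong : ∀ {l} (J : Junction l) {A : Set} {f g : A → Bool} xs →
            (∀ {x} → x ∈ xs → f x ≡ g x) → fold J f xs ≡ fold J g xs
fold-cong ∧-gate xs h = cong ListAction.and (map-cong-local (All.tabulate h))
fold-cong ∨-gate xs h = cong ListAction.or (map-cong-local (All.tabulate h))

fold-same-members : ∀ {l} (J : Junction l) {A : Set} (f : A → Bool) {xs ys} →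
                    xs ⊆ ys → ys ⊆ xs → fold J f xs ≡ fold J f ys
fold-same-members ∧-gate f xs⊆ys ys⊆xs = true⇔true⇒≡
  (λ e → to T-≡ (all-anti-mono f ys⊆xs (from T-≡ e)))
  (λ e → to T-≡ (all-anti-mono f xs⊆ys (from T-≡ e)))
fold-same-members ∨-gate f xs⊆ys ys⊆xs = true⇔true⇒≡
  (λ e → to T-≡ (Subset.any⁺ f xs⊆ys (from T-≡ e)))
  (λ e → to T-≡ (Subset.any⁺ f ys⊆xs (from T-≡ e)))

fold-mono : ∀ {l} (J : Junction l) {A : Set} {f g : A → Bool} xs →
            (∀ {x} → x ∈ xs → f x ≡ true → g x ≡ true) → fold J f xs ≡ true → fold J g xs ≡ true
fold-mono ∧-gate {f = f} {g} xs h e = all-true⁺ g xs λ m → h m (all-true⁻ f e m)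
fold-mono ∨-gate {f = f} {g} xs h e with any-true⁻ f xs e
... | x , x∈xs , fx = any-true⁺ g x∈xs (h x∈xs fx)

fold-absorbing : ∀ {l} (J : Junction l) {A : Set} (f : A → Bool) {xs x} →
                 x ∈ xs → f x ≡ not (neutral J) → fold J f xs ≡ not (neutral J)
fold-absorbing ∧-gate f {xs} x∈xs fx with all f xs in e
... | false = refl
... | true  = trans (sym (all-true⁻ f e x∈xs)) fx
fold-absorbing ∨-gate f x∈xs fx = any-true⁺ f x∈xs fx

fold-filter : ∀ {l} (J : Junction l) {A : Set} (f : A → Bool) (Q : A → Bool) xs →
              (∀ {x} → x ∈ xs → Q x ≡ false → f x ≡ neutral J) →
              fold J f xs ≡ fold J f (filter (λ x → Q x Bool.≟ true) xs)
fold-filter J f Q [] h = refl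
fold-filter J f Q (x ∷ xs) h with Q x in Qx
... | true  = trans (fold-∷ J f x xs) (trans (cong (combine J (f x)) (fold-filter J f Q xs (h ∘ there)))
                                               (sym (fold-∷ J f x _)))
... | false = trans (fold-∷ J f x xs) (trans (cong₂ (combine J) (h (here refl) Qx) (fold-filter J f Q xs (h ∘ there)))
                                               (combine-neutralˡ J _))

module Semantics (C : NNF) where

  ∈-preds⁻ : ∀ {u v} → u ∈ preds C v → (u , v) ∈ wires C
  ∈-preds⁻ {v = v} u∈ with ∈-map⁻ proj₁ u∈
  ... | _ , w∈ , refl with ∈-filter⁻ (λ w → proj₂ w ≟ v) {xs = wires C} w∈
  ... | w∈wires , refl = w∈wires

  ∈-preds⁺ : ∀ {u v} → (u , v) ∈ wires C → u ∈ preds C v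
  ∈-preds⁺ {v = v} w∈ = ∈-map⁺ proj₁ (∈-filter⁺ (λ w → proj₂ w ≟ v) w∈ refl)

  succs : Gate C → List (Gate C)
  succs v = map proj₂ (filter (λ w → proj₁ w ≟ v) (wires C))

  ∈-succs⁻ : ∀ {v w} → w ∈ succs v → (v , w) ∈ wires C
  ∈-succs⁻ {v} w∈ with ∈-map⁻ proj₂ w∈
  ... | _ , e∈ , refl with ∈-filter⁻ (λ w → proj₁ w ≟ v) {xs = wires C} e∈
  ... | e∈wires , refl = e∈wires

  ∈-succs⁺ : ∀ {v w} → (v , w) ∈ wires C → w ∈ succs v
  ∈-succs⁺ {v} v→w = ∈-map⁺ proj₂ (∈-filter⁺ (λ w → proj₁ w ≟ v) v→w refl)

  preds-unique : ∀ v → Unique (preds C v)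
  preds-unique v = Unique-map proj₁ (Unique.filter⁺ (λ w → proj₂ w ≟ v) (wires-unique C)) same-target
    where
    same-target : ∀ {x y} → x ∈ filter (λ w → proj₂ w ≟ v) (wires C) → y ∈ filter (λ w → proj₂ w ≟ v) (wires C) →
                  proj₁ x ≡ proj₁ y → x ≡ y
    same-target x∈ y∈ e with ∈-filter⁻ (λ w → proj₂ w ≟ v) {xs = wires C} x∈
                            | ∈-filter⁻ (λ w → proj₂ w ≟ v) {xs = wires C} y∈
    ... | _ , refl | _ , refl = cong₂ _,_ e refl

  wire-increasing : ∀ {u v} → (u , v) ∈ wires C → toℕ u < toℕ v
  wire-increasing = All.lookup (wires-topo C)

  gateValue : Assignment → (Gate C → Bool) → Gate C → Bool
  gateValue a h v with label C v
  ... | const b = b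
  ... | pos x   = a x
  ... | neg x   = not (a x)
  ... | and     = all h (preds C v)
  ... | or      = any h (preds C v)

  gateValue-cong : ∀ a {h h'} v → (∀ {u} → (u , v) ∈ wires C → h u ≡ h' u) →
                   gateValue a h v ≡ gateValue a h' v
  gateValue-cong a v e with label C v
  ... | const b = refl
  ... | pos x   = refl
  ... | neg x   = refl
  ... | and     = fold-cong ∧-gate (preds C v) (λ u∈ → e (∈-preds⁻ u∈))
  ... | or      = fold-cong ∨-gate (preds C v) (λ u∈ → e (∈-preds⁻ u∈))

  gateValue-junction : ∀ {l} (J : Junction l) a h v → label C v ≡ l →
                       gateValue a h v ≡ fold J h (preds C v)
  gateValue-junction ∧-gate a h v eq rewrite eq = refl
  gateValue-junction ∨-gate a h v eq rewrite eq = refl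

  gateValue-const : ∀ a h v {b} → label C v ≡ const b → gateValue a h v ≡ b
  gateValue-const a h v eq rewrite eq = refl

  gateValue-pos : ∀ a h v {x} → label C v ≡ pos x → gateValue a h v ≡ a x
  gateValue-pos a h v eq rewrite eq = refl

  evalFuel-suc : ∀ a k v → evalFuel C (suc k) a v ≡ gateValue a (evalFuel C k a) v
  evalFuel-suc a k v with label C v
  ... | const b = refl
  ... | pos x   = refl
  ... | neg x   = refl
  ... | and     = refl
  ... | or      = refl

  evalFuel-stable : ∀ a k k' v → toℕ v < k → toℕ v < k' → evalFuel C k a v ≡ evalFuel C k' a v
  evalFuel-stable a (suc k) (suc k') v v<k v<k' =
    trans (evalFuel-suc a k v)
      (trans (gateValue-cong a v λ w∈ → let u<v = wire-increasing w∈ in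
                evalFuel-stable a k k' _ (ℕ.<-≤-trans u<v (ℕ.≤-pred v<k)) (ℕ.<-≤-trans u<v (ℕ.≤-pred v<k')))
        (sym (evalFuel-suc a k' v)))

  val : Assignment → Gate C → Bool
  val a v = evalFuel C (suc (toℕ v)) a v

  evalFuel≡val : ∀ a k v → toℕ v < k → evalFuel C k a v ≡ val a v
  evalFuel≡val a k v v<k = evalFuel-stable a k (suc (toℕ v)) v v<k ℕ.≤-refl

  val-fixpoint : ∀ a v → val a v ≡ gateValue a (val a) v
  val-fixpoint a v = trans (evalFuel-suc a (toℕ v) v)
    (gateValue-cong a v λ w∈ → evalFuel≡val a (toℕ v) _ (wire-increasing w∈))

  fixpoint-unique : ∀ a (h : Gate C → Bool) → (∀ v → h v ≡ gateValue a h v) → ∀ v → h v ≡ val a v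
  fixpoint-unique a h fix v = go (suc (toℕ v)) v ℕ.≤-refl
    where
    go : ∀ k v → toℕ v < k → h v ≡ val a v
    go (suc k) v v<k = begin
      h v                   ≡⟨ fix v ⟩
      gateValue a h v       ≡⟨ gateValue-cong a v (λ w∈ → go k _ (ℕ.<-≤-trans (wire-increasing w∈) (ℕ.≤-pred v<k))) ⟩
      gateValue a (val a) v ≡⟨ val-fixpoint a v ⟨
      val a v               ∎
      where open ≡-Reasoning

  eval≡val-output : ∀ a → eval C a ≡ val a (output C)
  eval≡val-output a = evalFuel≡val a (suc (n C)) (output C) (ℕ.≤-reflexive (cong suc (toℕ-fromℕ (n C))))

  Reach-snoc : ∀ {w u v} → Reach C w u → (u , v) ∈ wires C → Reach C w v
  Reach-snoc here       u→v = step u→v here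
  Reach-snoc (step m r) u→v = step m (Reach-snoc r u→v)

  InVarsSub-wire : ∀ {u v x} → (u , v) ∈ wires C → InVarsSub C u x → InVarsSub C v x
  InVarsSub-wire u→v (w , w↝u , lw) = w , Reach-snoc w↝u u→v , lw

  evalFuel-vars : ∀ k a a' v → (∀ x → InVarsSub C v x → a x ≡ a' x) → evalFuel C k a v ≡ evalFuel C k a' v
  evalFuel-vars zero a a' v e = refl
  evalFuel-vars (suc k) a a' v e with label C v in lv
  ... | const b = refl
  ... | pos x   = e x (v , here , inj₁ lv)
  ... | neg x   = cong not (e x (v , here , inj₂ lv))
  ... | and     = fold-cong ∧-gate (preds C v) λ u∈ →
                    evalFuel-vars k a a' _ (λ x i → e x (InVarsSub-wire (∈-preds⁻ u∈) i))
  ... | or      = fold-cong ∨-gate (preds C v) λ u∈ →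
                    evalFuel-vars k a a' _ (λ x i → e x (InVarsSub-wire (∈-preds⁻ u∈) i))

  NoNeg : Set
  NoNeg = ∀ v x → label C v ≢ neg x

  evalFuel-mono : NoNeg → ∀ k a a' v → (∀ x → a x ≡ true → a' x ≡ true) →
                  evalFuel C k a v ≡ true → evalFuel C k a' v ≡ true
  evalFuel-mono noNeg (suc k) a a' v a≤a' with label C v in lv
  ... | const b = λ e → e
  ... | pos x   = a≤a' x
  ... | neg x   = ⊥-elim (noNeg v x lv)
  ... | and     = fold-mono ∧-gate (preds C v) λ _ → evalFuel-mono noNeg k a a' _ a≤a'
  ... | or      = fold-mono ∨-gate (preds C v) λ _ → evalFuel-mono noNeg k a a' _ a≤a'

  val-mono : NoNeg → ∀ a a' v → (∀ x → a x ≡ true → a' x ≡ true) → val a v ≡ true → val a' v ≡ true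
  val-mono noNeg a a' v = evalFuel-mono noNeg (suc (toℕ v)) a a' v

-- Replacing negative literals by 1

dropNeg : Label → Label
dropNeg (neg x) = const true
dropNeg l       = l

dropNeg-input⁺ : ∀ l → IsInputLabel l → IsInputLabel (dropNeg l)
dropNeg-input⁺ (const b) _ = tt
dropNeg-input⁺ (pos x)   _ = tt
dropNeg-input⁺ (neg x)   _ = tt

dropNeg-input⁻ : ∀ l → IsInputLabel (dropNeg l) → IsInputLabel l
dropNeg-input⁻ (const b) _ = tt
dropNeg-input⁻ (pos x)   _ = tt
dropNeg-input⁻ (neg x)   _ = tt

positivePart : NNF → NNF
positivePart D = record
  { n              = n D
  ; label          = λ v → dropNeg (label D v)
  ; wires          = wires D
  ; wires-unique   = wires-unique D
  ; wires-topo     = wires-topo D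
  ; input-source   = λ v i → input-source D v (dropNeg-input⁻ (label D v) i)
  ; noninput-wired = λ v ni → noninput-wired D v (λ i → ni (dropNeg-input⁺ (label D v) i))
  ; unique-sink    = unique-sink D
  }

Monotone : NNF → Set
Monotone D = ∀ a b → (∀ x → a x ≡ true → b x ≡ true) → eval D a ≡ true → eval D b ≡ true

module PositivePart (D : NNF) where

  D⁺ : NNF
  D⁺ = positivePart D

  open Semantics D using (∈-preds⁻; wire-increasing; evalFuel-vars; InVarsSub-wire)

  positivePart-noNeg : Semantics.NoNeg D⁺
  positivePart-noNeg v x e with label D v
  positivePart-noNeg v x () | neg y
  positivePart-noNeg v x () | pos y
  positivePart-noNeg v x () | const b

  InVarsSub-positivePart : ∀ {v x} → InVarsSub D⁺ v x → InVarsSub D v x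
  InVarsSub-positivePart {x = x} (u , u↝v , lu) = u , reach u↝v , literal lu
    where
    reach : ∀ {u v} → Reach D⁺ u v → Reach D u v
    reach here       = here
    reach (step m r) = step m (reach r)
    dropNeg-pos : ∀ l → dropNeg l ≡ pos x → l ≡ pos x
    dropNeg-pos (pos y) refl = refl
    dropNeg-pos (neg y) ()
    literal : label D⁺ u ≡ pos x ⊎ label D⁺ u ≡ neg x → label D u ≡ pos x ⊎ label D u ≡ neg x
    literal (inj₁ lu) = inj₁ (dropNeg-pos (label D u) lu)
    literal (inj₂ lu) = ⊥-elim (positivePart-noNeg u x lu)

  positivePart-isDNNF : IsDNNF D → IsDNNF D⁺
  positivePart-isDNNF dnnf v lv u₁ u₂ m₁ m₂ u₁≢u₂ x i₁ i₂ =
    dnnf v (and-label (label D v) lv) u₁ u₂ m₁ m₂ u₁≢u₂ x (InVarsSub-positivePart i₁) (InVarsSub-positivePart i₂)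
    where
    and-label : ∀ l → dropNeg l ≡ and → l ≡ and
    and-label and refl = refl
    and-label (neg x) ()

  evalFuel-≤-positivePart : ∀ k a v → evalFuel D k a v ≡ true → evalFuel D⁺ k a v ≡ true
  evalFuel-≤-positivePart (suc k) a v with label D v
  ... | const b = λ e → e
  ... | pos x   = λ e → e
  ... | neg x   = λ _ → refl
  ... | and     = fold-mono ∧-gate (preds D v) λ _ → evalFuel-≤-positivePart k a _
  ... | or      = fold-mono ∨-gate (preds D v) λ _ → evalFuel-≤-positivePart k a _

  clearVar : Assignment → Var → Assignment
  clearVar a x y with y ℕ.≟ x
  ... | yes _ = false
  ... | no  _ = a y

  mutual
    witness : ℕ → Assignment → Gate D → Assignment
    witness zero    a v = a
    witness (suc k) a v with label D v
    ... | const _ = a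
    ... | pos _   = a
    ... | neg x   = clearVar a x
    ... | and     = λ y → a y ∧ all (λ u → witness k a u y) (preds D v)
    ... | or      = firstWitness k a (preds D v)

    firstWitness : ℕ → Assignment → List (Gate D) → Assignment
    firstWitness k a []       = a
    firstWitness k a (u ∷ us) = if evalFuel D⁺ k a u then witness k a u else firstWitness k a us

  firstWitness-satisfied : ∀ k a us → any (evalFuel D⁺ k a) us ≡ true →
    ∃ λ u → u ∈ us × evalFuel D⁺ k a u ≡ true × firstWitness k a us ≡ witness k a u
  firstWitness-satisfied k a (u ∷ us) e with evalFuel D⁺ k a u in eu
  ... | true  = u , here refl , eu , refl
  ... | false with firstWitness-satisfied k a us e
  ... | w , w∈ , ew , eq = w , there w∈ , ew , eq

  -- value is a parameter, not a field, so that `with label D v` in witness-correct also abstracts it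
  record IsWitness (a : Assignment) (v : Gate D) (b : Assignment) (value : Bool) : Set where
    field
      below     : ∀ y → b y ≡ true → a y ≡ true
      outside   : ∀ y → ¬ InVarsSub D v y → b y ≡ a y
      satisfies : value ≡ true
  open IsWitness

  clearVar-witness : ∀ {a v x} → label D v ≡ neg x → IsWitness a v (clearVar a x) (not (clearVar a x x))
  clearVar-witness {a} {v} {x} lv = record { below = below-neg ; outside = outside-neg ; satisfies = satisfies-neg }
    where
    below-neg : ∀ y → clearVar a x y ≡ true → a y ≡ true
    below-neg y p with y ℕ.≟ x
    ... | no _ = p
    outside-neg : ∀ y → ¬ InVarsSub D v y → clearVar a x y ≡ a y
    outside-neg y y∉ with y ℕ.≟ x
    ... | yes refl = ⊥-elim (y∉ (v , here , inj₂ lv))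
    ... | no  _    = refl
    satisfies-neg : not (clearVar a x x) ≡ true
    satisfies-neg with x ℕ.≟ x
    ... | yes _  = refl
    ... | no x≢x = ⊥-elim (x≢x refl)

  meet-witness : IsDNNF D → ∀ {k a v} → label D v ≡ and →
                 (∀ {u} → u ∈ preds D v → IsWitness a u (witness k a u) (evalFuel D k (witness k a u) u)) →
                 let b = λ y → a y ∧ all (λ u → witness k a u y) (preds D v) in
                 IsWitness a v b (all (evalFuel D k b) (preds D v))
  meet-witness dnnf {k} {a} {v} lv IH = record { below = λ y p → ∧-true⁻ˡ p ; outside = outside-and ; satisfies = satisfies-and }
    where
    b : Assignment
    b y = a y ∧ all (λ u → witness k a u y) (preds D v)
    outside-and : ∀ y → ¬ InVarsSub D v y → b y ≡ a y
    outside-and y y∉ = true⇔true⇒≡ ∧-true⁻ˡ λ ay → ∧-true⁺ ay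
      (all-true⁺ _ (preds D v) λ u∈ → trans (outside (IH u∈) y (λ i → y∉ (InVarsSub-wire (∈-preds⁻ u∈) i))) ay)
    -- by decomposability a variable of u lies outside every other input w, where w's witness agrees with a
    agrees : ∀ {u} → u ∈ preds D v → ∀ y → InVarsSub D u y → b y ≡ witness k a u y
    agrees {u} u∈ y y∈u = true⇔true⇒≡ (λ p → all-true⁻ _ (∧-true⁻ʳ p) u∈) λ p →
      let ay = below (IH u∈) y p in
      ∧-true⁺ ay (all-true⁺ _ (preds D v) λ {w} w∈ → others w w∈ p ay)
      where
      others : ∀ w → w ∈ preds D v → witness k a u y ≡ true → a y ≡ true → witness k a w y ≡ true
      others w w∈ p ay with w ≟ u
      ... | yes refl = p
      ... | no w≢u   = trans (outside (IH w∈) y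
              (dnnf v lv u w (∈-preds⁻ u∈) (∈-preds⁻ w∈) (λ u≡w → w≢u (sym u≡w)) y y∈u)) ay
    satisfies-and : all (evalFuel D k b) (preds D v) ≡ true
    satisfies-and = all-true⁺ _ (preds D v) λ u∈ →
      trans (evalFuel-vars k b (witness k a _) _ (agrees u∈)) (satisfies (IH u∈))

  witness-correct : IsDNNF D → ∀ k a v → toℕ v < k → evalFuel D⁺ k a v ≡ true →
                    IsWitness a v (witness k a v) (evalFuel D k (witness k a v) v)
  witness-correct dnnf (suc k) a v v<k e with label D v in lv
  ... | const b = record { below = λ _ p → p ; outside = λ _ _ → refl ; satisfies = e }
  ... | pos x   = record { below = λ _ p → p ; outside = λ _ _ → refl ; satisfies = e }
  ... | neg x   = clearVar-witness lv
  ... | and     = meet-witness dnnf {k} lv λ u∈ →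
                    witness-correct dnnf k a _ (ℕ.<-≤-trans (wire-increasing (∈-preds⁻ u∈)) (ℕ.≤-pred v<k))
                                    (all-true⁻ _ e u∈)
  ... | or with firstWitness-satisfied k a (preds D v) e
  ... | u , u∈ , eu , chosen rewrite chosen =
    record { below = below IH ; outside = λ y y∉ → outside IH y (λ i → y∉ (InVarsSub-wire (∈-preds⁻ u∈) i))
           ; satisfies = any-true⁺ _ u∈ (satisfies IH) }
    where
    IH : IsWitness a u (witness k a u) (evalFuel D k (witness k a u) u)
    IH = witness-correct dnnf k a u (ℕ.<-≤-trans (wire-increasing (∈-preds⁻ u∈)) (ℕ.≤-pred v<k)) eu

  positivePart-equivalent : IsDNNF D → Monotone D → Equivalent D⁺ D
  positivePart-equivalent dnnf mono a = true⇔true⇒≡ via-witness (evalFuel-≤-positivePart (suc (n D)) a (output D))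
    where
    via-witness : eval D⁺ a ≡ true → eval D a ≡ true
    via-witness e = mono _ a (below W) (satisfies W)
      where
      W = witness-correct dnnf (suc (n D)) a (output D) (ℕ.≤-reflexive (cong suc (toℕ-fromℕ (n D)))) e

-- Binarising a negation-free DNNF whose output is not constant

allTrue allFalse : Assignment
allTrue  _ = true
allFalse _ = false

module Binarization (P : NNF) (dnnf : IsDNNF P) (noNeg : Semantics.NoNeg P)
  (output-true : Semantics.val P allTrue (output P) ≡ true)
  (output-false : Semantics.val P allFalse (output P) ≡ false) where

  open Semantics P

  nonConstant : Gate P → Bool
  nonConstant v = val allTrue v ∧ not (val allFalse v)

  nonConstant-¬constant : ∀ {v b} → nonConstant v ≡ true → ¬ (∀ a → val a v ≡ b)
  nonConstant-¬constant {v} {b} nc constant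
    with trans (sym (subst₂ (λ x y → x ∧ not y ≡ true) (constant allTrue) (constant allFalse) nc)) (∧-inverseʳ b)
  ... | ()

  constant-unless-nonConstant : ∀ {u} → nonConstant u ≡ false → ∃ λ b → ∀ a → val a u ≡ b
  constant-unless-nonConstant {u} nc with val allTrue u in e1 | val allFalse u in e0
  ... | false | _ = false , λ a → true⇔true⇒≡ (λ e → trans (sym e1) (val-mono noNeg a allTrue u (λ _ _ → refl) e)) λ ()
  ... | true | true = true , λ a → val-mono noNeg allFalse a u (λ _ ()) e0

  const-constant : ∀ {v b} → label P v ≡ const b → ∀ a → val a v ≡ b
  const-constant {v} lv a = trans (val-fixpoint a v) (gateValue-const a (val a) v lv)

  nonConstant-¬const : ∀ {v b} → nonConstant v ≡ true → label P v ≢ const b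
  nonConstant-¬const nc lv = nonConstant-¬constant nc (const-constant lv)

  essential : Gate P → List (Gate P)
  essential v = filter (λ u → nonConstant u Bool.≟ true) (preds P v)

  ∈-essential⁻ : ∀ {u v} → u ∈ essential v → (u , v) ∈ wires P × nonConstant u ≡ true
  ∈-essential⁻ u∈ with ∈-filter⁻ (λ u → nonConstant u Bool.≟ true) u∈
  ... | u∈preds , nc = ∈-preds⁻ u∈preds , nc

  ∈-essential⁺ : ∀ {u v} → (u , v) ∈ wires P → nonConstant u ≡ true → u ∈ essential v
  ∈-essential⁺ u→v nc = ∈-filter⁺ (λ u → nonConstant u Bool.≟ true) (∈-preds⁺ u→v) nc

  essential-unique : ∀ v → Unique (essential v)
  essential-unique v = Unique.filter⁺ (λ u → nonConstant u Bool.≟ true) (preds-unique v)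

  essential-of-input : ∀ {v} → IsInputLabel (label P v) → essential v ≡ []
  essential-of-input {v} input with essential v in ev
  ... | []    = refl
  ... | u ∷ _ = ⊥-elim (input-source P v input u (proj₁ (∈-essential⁻ (subst (u ∈_) (sym ev) (here refl)))))

  val-junction : ∀ {l} (J : Junction l) a v → label P v ≡ l → val a v ≡ fold J (val a) (preds P v)
  val-junction J a v lv = trans (val-fixpoint a v) (gateValue-junction J a (val a) v lv)

  -- a constant input of a non-constant gate cannot be absorbing, so it is neutral
  constant-input-neutral : ∀ {l} (J : Junction l) {u v b} → label P v ≡ l → nonConstant v ≡ true →
                           u ∈ preds P v → (∀ a → val a u ≡ b) → b ≡ neutral J
  constant-input-neutral J {u} {v} {b} lv nc u∈ constant with neutral-or-absorbing J b
  ... | inj₁ b≡neutral   = b≡neutral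
  ... | inj₂ b≡absorbing = ⊥-elim (nonConstant-¬constant nc λ a →
          trans (val-junction J a v lv) (fold-absorbing J (val a) u∈ (trans (constant a) b≡absorbing)))

  val-essential : ∀ {l} (J : Junction l) a v → label P v ≡ l → nonConstant v ≡ true →
                  val a v ≡ fold J (val a) (essential v)
  val-essential J a v lv nc = trans (val-junction J a v lv) (fold-filter J (val a) nonConstant (preds P v) neutral-input)
    where
    neutral-input : ∀ {u} → u ∈ preds P v → nonConstant u ≡ false → val a u ≡ neutral J
    neutral-input u∈ nc-u with constant-unless-nonConstant nc-u
    ... | b , constant = trans (constant a) (constant-input-neutral J lv nc u∈ constant)

  essential-nonempty : ∀ {l} (J : Junction l) v → label P v ≡ l → nonConstant v ≡ true → 0 < length (essential v)
  essential-nonempty J v lv nc with essential v in ev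
  ... | _ ∷ _ = s≤s z≤n
  ... | []    = ⊥-elim (nonConstant-¬constant nc λ a →
                  trans (val-essential J a v lv nc) (trans (cong (fold J (val a)) ev) (fold-[] J (val a))))

  isOutput : Gate P → Bool
  isOutput v = does (v ≟ output P)

  -- fuel bounds the distance to the output, which decreases along wires
  liveFuel : ℕ → Gate P → Bool
  liveFuel zero    v = false
  liveFuel (suc f) v = nonConstant v ∧ (isOutput v ∨ any (liveFuel f) (succs v))

  live : Gate P → Bool
  live v = liveFuel (suc (n P ∸ toℕ v)) v

  distance-decreasing : ∀ {v w} → (v , w) ∈ wires P → n P ∸ toℕ w < n P ∸ toℕ v
  distance-decreasing {v} {w} v→w = ℕ.∸-monoʳ-< (wire-increasing v→w) (toℕ≤pred[n] w)

  liveFuel-stable : ∀ f f' v → n P ∸ toℕ v < f → n P ∸ toℕ v < f' → liveFuel f v ≡ liveFuel f' v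
  liveFuel-stable (suc f) (suc f') v v<f v<f' = cong (λ t → nonConstant v ∧ (isOutput v ∨ t))
    (fold-cong ∨-gate (succs v) λ w∈ → let d = distance-decreasing (∈-succs⁻ w∈) in
       liveFuel-stable f f' _ (ℕ.<-≤-trans d (ℕ.≤-pred v<f)) (ℕ.<-≤-trans d (ℕ.≤-pred v<f')))

  live-unfold : ∀ v → live v ≡ nonConstant v ∧ (isOutput v ∨ any live (succs v))
  live-unfold v = cong (λ t → nonConstant v ∧ (isOutput v ∨ t))
    (fold-cong ∨-gate (succs v) λ w∈ → liveFuel-stable _ _ _ (distance-decreasing (∈-succs⁻ w∈)) ℕ.≤-refl)

  live-output : live (output P) ≡ true
  live-output rewrite live-unfold (output P) with output P ≟ output P
  ... | no out≢out = ⊥-elim (out≢out refl)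
  ... | yes _ rewrite output-true | output-false = refl

  live⇒nonConstant : ∀ {v} → live v ≡ true → nonConstant v ≡ true
  live⇒nonConstant {v} lv = ∧-true⁻ˡ (trans (sym (live-unfold v)) lv)

  live-successor : ∀ {v} → live v ≡ true → v ≢ output P → ∃ λ w → (v , w) ∈ wires P × live w ≡ true
  live-successor {v} lv v≢out with v ≟ output P | ∧-true⁻ʳ {nonConstant v} (trans (sym (live-unfold v)) lv)
  ... | yes v≡out | _ = ⊥-elim (v≢out v≡out)
  ... | no _      | e with any-true⁻ live (succs v) e
  ... | w , w∈ , lw = w , ∈-succs⁻ w∈ , lw

  live-input : ∀ {v w} → (v , w) ∈ wires P → live w ≡ true → nonConstant v ≡ true → live v ≡ true
  live-input {v} v→w lw nc rewrite live-unfold v | nc with isOutput v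
  ... | true  = refl
  ... | false = any-true⁺ live (∈-succs⁺ v→w) lw

  essential-live : ∀ {u v} → live v ≡ true → u ∈ essential v → live u ≡ true
  essential-live lv u∈ = live-input (proj₁ (∈-essential⁻ u∈)) lv (proj₂ (∈-essential⁻ u∈))

  -- gate v gets slots 0 … width v - 1; slot j computes the junction of the first j + 1 essential inputs of v
  width : Gate P → ℕ
  width v = suc (pred (length (essential v)))

  length≤width : ∀ v → length (essential v) ≤ width v
  length≤width v with length (essential v)
  ... | zero  = z≤n
  ... | suc _ = ℕ.≤-refl

  stride : ℕ
  stride = suc (length (wires P))

  width≤stride : ∀ v → width v ≤ stride
  width≤stride v = s≤s (ℕ.≤-trans ℕ.pred[n]≤n (begin
    length (essential v)                          ≤⟨ length-filter (λ u → nonConstant u Bool.≟ true) (preds P v) ⟩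
    length (preds P v)                            ≡⟨ length-map proj₁ (filter (λ w → proj₂ w ≟ v) (wires P)) ⟩
    length (filter (λ w → proj₂ w ≟ v) (wires P)) ≤⟨ length-filter (λ w → proj₂ w ≟ v) (wires P) ⟩
    length (wires P)                              ∎))
    where open ℕ.≤-Reasoning

  -- positions are numbered lexicographically in (gate, slot), so wires of P go to larger positions
  position : Gate P → ℕ → ℕ
  position v j = toℕ v * stride + j

  position-suc : ∀ v j → position v (suc j) ≡ suc (position v j)
  position-suc v j = ℕ.+-suc (toℕ v * stride) j

  positions : ℕ
  positions = suc (n P) * stride

  position-<-gate : ∀ {v w} j j' → toℕ v < toℕ w → j < stride → position v j < position w j'
  position-<-gate {v} {w} j j' v<w j<stride = begin-strict
    toℕ v * stride + j      <⟨ ℕ.+-monoʳ-< (toℕ v * stride) j<stride ⟩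
    toℕ v * stride + stride ≡⟨ ℕ.+-comm (toℕ v * stride) stride ⟩
    suc (toℕ v) * stride    ≤⟨ ℕ.*-monoˡ-≤ stride v<w ⟩
    toℕ w * stride          ≤⟨ ℕ.m≤m+n (toℕ w * stride) j' ⟩
    toℕ w * stride + j'     ∎
    where open ℕ.≤-Reasoning

  position-injective : ∀ {v v' j j'} → j < stride → j' < stride → position v j ≡ position v' j' → v ≡ v' × j ≡ j'
  position-injective {v} {v'} {j} {j'} j< j'< e with ℕ.<-cmp (toℕ v) (toℕ v')
  ... | tri< v<v' _ _ = ⊥-elim (ℕ.<⇒≢ (position-<-gate j j' v<v' j<) e)
  ... | tri> _ _ v'<v = ⊥-elim (ℕ.<⇒≢ (position-<-gate j' j v'<v j'<) (sym e))
  ... | tri≈ _ v≡v' _ with toℕ-injective v≡v'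
  ... | refl = refl , ℕ.+-cancelˡ-≡ (toℕ v * stride) j j' e

  position-bounded : ∀ v {j} → j < stride → position v j < positions
  position-bounded v {j} j<stride = begin-strict
    toℕ v * stride + j      <⟨ ℕ.+-monoʳ-< (toℕ v * stride) j<stride ⟩
    toℕ v * stride + stride ≡⟨ ℕ.+-comm (toℕ v * stride) stride ⟩
    suc (toℕ v) * stride    ≤⟨ ℕ.*-monoˡ-≤ stride (s≤s (toℕ≤pred[n] v)) ⟩
    positions               ∎
    where open ℕ.≤-Reasoning

  -- the ⊓ only makes gateOf total; below positions, decoding inverts position (position-decode)
  gateOf : ℕ → Gate P
  gateOf p = fromℕ< (s≤s (ℕ.m⊓n≤n (p / stride) (n P)))

  slotOf : ℕ → ℕ
  slotOf p = p % stride

  slotOf-< : ∀ p → slotOf p < stride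
  slotOf-< p = m%n<n p stride

  position-decode : ∀ {p} → p < positions → position (gateOf p) (slotOf p) ≡ p
  position-decode {p} p< rewrite toℕ-fromℕ< (s≤s (ℕ.m⊓n≤n (p / stride) (n P)))
                               | ℕ.m≤n⇒m⊓n≡m (ℕ.≤-pred (m<n*o⇒m/o<n {p} {suc (n P)} {stride} p<))
    = trans (ℕ.+-comm (p / stride * stride) (p % stride)) (sym (m≡m%n+[m/n]*n p stride))

  decode-position : ∀ v {j} → j < stride → gateOf (position v j) ≡ v × slotOf (position v j) ≡ j
  decode-position v {j} j< = position-injective (slotOf-< (position v j)) j< (position-decode (position-bounded v j<))

  LivePosition : ℕ → Set
  LivePosition p = p < positions × live (gateOf p) ≡ true × slotOf p < width (gateOf p)

  livePosition? : ∀ p → Dec (LivePosition p)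
  livePosition? p = (p ℕ.<? positions) ×-dec (live (gateOf p) Bool.≟ true) ×-dec (slotOf p ℕ.<? width (gateOf p))

  livePosition : ∀ {v j} → live v ≡ true → j < width v → LivePosition (position v j)
  livePosition {v} {j} lv j<w with decode-position v (ℕ.≤-trans j<w (width≤stride v))
  ... | gate≡ , slot≡ = position-bounded v (ℕ.≤-trans j<w (width≤stride v)) ,
                        subst (λ w → live w ≡ true) (sym gate≡) lv ,
                        subst₂ (λ i w → i < width w) (sym slot≡) (sym gate≡) j<w

  -- the last slot of v, which computes v itself (prefixValue-top)
  top : Gate P → ℕ
  top v = position v (pred (length (essential v)))

  livePosition-top : ∀ {v} → live v ≡ true → LivePosition (top v)
  livePosition-top lv = livePosition lv ℕ.≤-refl

  livePosition-≤-top-output : ∀ {p} → LivePosition p → p ≤ top (output P)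
  livePosition-≤-top-output {p} (p< , _ , slot<) with gateOf p ≟ output P
  ... | yes gate≡out = subst (_≤ top (output P)) (position-decode p<)
                         (subst (λ v → position v (slotOf p) ≤ top (output P)) (sym gate≡out)
                           (ℕ.+-monoʳ-≤ (toℕ (output P) * stride)
                             (ℕ.≤-pred (subst (λ v → slotOf p < width v) gate≡out slot<))))
  ... | no gate≢out = subst (_≤ top (output P)) (position-decode p<)
                        (ℕ.<⇒≤ (position-<-gate (slotOf p) _ gate<out (slotOf-< p)))
    where
    gate<out : toℕ (gateOf p) < toℕ (output P)
    gate<out = ℕ.≤∧≢⇒< (subst (toℕ (gateOf p) ≤_) (sym (toℕ-fromℕ (n P))) (toℕ≤pred[n] (gateOf p)))
                       (λ e → gate≢out (toℕ-injective e))

  opaque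
    livePositions : List ℕ
    livePositions = filter livePosition? (upTo positions)

    ∈-livePositions⁻ : ∀ {p} → p ∈ livePositions → LivePosition p
    ∈-livePositions⁻ p∈ = proj₂ (∈-filter⁻ livePosition? {xs = upTo positions} p∈)

    ∈-livePositions⁺ : ∀ {p} → LivePosition p → p ∈ livePositions
    ∈-livePositions⁺ lp = ∈-filter⁺ livePosition? (∈-upTo⁺ (proj₁ lp)) lp

    livePositions-sorted : AllPairs _<_ livePositions
    livePositions-sorted = AllPairs.filter⁺ livePosition? (AllPairs.applyUpTo⁺₁ (λ i → i) positions (λ i<j _ → i<j))

  -- the gates of D′ are the live positions in increasing order, the last one being the last slot of the output
  lastIndex : ℕ
  lastIndex = pred (length livePositions)

  Gate′ : Set
  Gate′ = Fin (suc lastIndex)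

  length-livePositions : length livePositions ≡ suc lastIndex
  length-livePositions with livePositions | ∈-livePositions⁺ (livePosition-top live-output)
  ... | _ ∷ _ | _ = refl

  positionOf : Gate′ → ℕ
  positionOf r = nth livePositions (toℕ r)

  positionOf-index : ∀ (r : Gate′) → toℕ r < length livePositions
  positionOf-index r = subst (toℕ r <_) (sym length-livePositions) (toℕ<n r)

  positionOf-live : ∀ r → LivePosition (positionOf r)
  positionOf-live r = ∈-livePositions⁻ (nth-∈ livePositions (positionOf-index r))

  positionOf-strictMono : ∀ {r s} → toℕ r < toℕ s → positionOf r < positionOf s
  positionOf-strictMono {s = s} r<s = nth-strictMono livePositions-sorted r<s (positionOf-index s)

  positionOf-injective : ∀ {r s} → positionOf r ≡ positionOf s → r ≡ s
  positionOf-injective {r} {s} e with ℕ.<-cmp (toℕ r) (toℕ s)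
  ... | tri< r<s _ _ = ⊥-elim (ℕ.<⇒≢ (positionOf-strictMono r<s) e)
  ... | tri≈ _ r≡s _ = toℕ-injective r≡s
  ... | tri> _ _ s<r = ⊥-elim (ℕ.<⇒≢ (positionOf-strictMono s<r) (sym e))

  positionOf-reflects-< : ∀ {r s} → positionOf r < positionOf s → toℕ r < toℕ s
  positionOf-reflects-< {r} {s} p<q with ℕ.<-cmp (toℕ r) (toℕ s)
  ... | tri< r<s _ _ = r<s
  ... | tri≈ _ r≡s _ = ⊥-elim (ℕ.<-irrefl (cong positionOf (toℕ-injective r≡s)) p<q)
  ... | tri> _ _ s<r = ⊥-elim (ℕ.<-asym p<q (positionOf-strictMono s<r))

  positionOf-surjective : ∀ {p} → LivePosition p → ∃ λ r → positionOf r ≡ p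
  positionOf-surjective lp with ∈⇒nth (∈-livePositions⁺ lp)
  ... | i , i<n , e = fromℕ< (subst (i <_) length-livePositions i<n) ,
                      trans (cong (nth livePositions) (toℕ-fromℕ< _)) e

  positionOf-last : positionOf (fromℕ lastIndex) ≡ top (output P)
  positionOf-last with positionOf-surjective (livePosition-top live-output)
  ... | r , r↦top = ℕ.≤-antisym (livePosition-≤-top-output (positionOf-live _))
                                (subst (_≤ positionOf (fromℕ lastIndex)) r↦top (below-last r))
    where
    below-last : ∀ r → positionOf r ≤ positionOf (fromℕ lastIndex)
    below-last r with ℕ.m≤n⇒m<n∨m≡n (subst (toℕ r ≤_) (sym (toℕ-fromℕ lastIndex)) (toℕ≤pred[n] r))
    ... | inj₁ r<last = ℕ.<⇒≤ (positionOf-strictMono r<last)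
    ... | inj₂ r≡last = ℕ.≤-reflexive (cong positionOf (toℕ-injective r≡last))

  childTop : ℕ → Maybe ℕ
  childTop q = Maybe.map top (lookup? (essential (gateOf q)) (slotOf q))

  childTop⁻ : ∀ {q p} → childTop q ≡ just p → ∃ λ c → lookup? (essential (gateOf q)) (slotOf q) ≡ just c × p ≡ top c
  childTop⁻ {q} e with lookup? (essential (gateOf q)) (slotOf q)
  childTop⁻ refl | just c = c , refl , refl

  childTop-position : ∀ v {j} → j < stride → childTop (position v j) ≡ Maybe.map top (lookup? (essential v) j)
  childTop-position v j< with decode-position v j<
  ... | gate≡ , slot≡ = cong₂ (λ w i → Maybe.map top (lookup? (essential w) i)) gate≡ slot≡

  -- slot j of gate v is fed by slot j - 1 of v and by the last slot of the j-th essential input of v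
  Wire : ℕ → ℕ → Set
  Wire p q = LivePosition q × ((suc p ≡ q × 0 < slotOf q) ⊎ childTop q ≡ just p)

  wire? : ∀ p q → Dec (Wire p q)
  wire? p q = livePosition? q ×-dec
    (((suc p ℕ.≟ q) ×-dec (0 ℕ.<? slotOf q)) ⊎-dec ≡-dec-Maybe ℕ._≟_ (childTop q) (just p))

  Wire-< : ∀ {p q} → Wire p q → p < q
  Wire-< (_ , inj₁ (refl , _)) = ℕ.≤-refl
  Wire-< {p} {q} ((q< , _) , inj₂ e) with childTop⁻ {q} e
  ... | c , c-at , refl = subst (top c <_) (position-decode {q} q<)
        (position-<-gate {c} {gateOf q} _ (slotOf q)
          (wire-increasing (proj₁ (∈-essential⁻ (lookup?-∈ (essential (gateOf q)) c-at)))) (width≤stride c))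

  opaque
    wires′ : List (Gate′ × Gate′)
    wires′ = filter (λ w → wire? (positionOf (proj₁ w)) (positionOf (proj₂ w)))
                    (cartesianProduct (allFin _) (allFin _))

    ∈-wires′⁻ : ∀ {r s} → (r , s) ∈ wires′ → Wire (positionOf r) (positionOf s)
    ∈-wires′⁻ w∈ = proj₂ (∈-filter⁻ (λ w → wire? (positionOf (proj₁ w)) (positionOf (proj₂ w))) w∈)

    ∈-wires′⁺ : ∀ {r s} → Wire (positionOf r) (positionOf s) → (r , s) ∈ wires′
    ∈-wires′⁺ {r} {s} = ∈-filter⁺ (λ w → wire? (positionOf (proj₁ w)) (positionOf (proj₂ w)))
                                  (∈-cartesianProduct⁺ (∈-allFin r) (∈-allFin s))

    wires′-unique : Unique wires′
    wires′-unique = Unique.filter⁺ (λ w → wire? (positionOf (proj₁ w)) (positionOf (proj₂ w)))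
                                   (Unique.cartesianProduct⁺ (Unique.allFin⁺ _) (Unique.allFin⁺ _))

  gateAt : Gate′ → Gate P
  gateAt r = gateOf (positionOf r)

  slotAt : Gate′ → ℕ
  slotAt r = slotOf (positionOf r)

  label′ : Gate′ → Label
  label′ r = label P (gateAt r)

  positionOf-decode : ∀ r → positionOf r ≡ position (gateAt r) (slotAt r)
  positionOf-decode r = sym (position-decode (proj₁ (positionOf-live r)))

  gateAt-slotAt : ∀ {u v j} → j < stride → positionOf u ≡ position v j → gateAt u ≡ v × slotAt u ≡ j
  gateAt-slotAt {u} j< u↦ = position-injective (slotOf-< (positionOf u)) j< (trans (sym (positionOf-decode u)) u↦)

  gateAt-live : ∀ r → live (gateAt r) ≡ true
  gateAt-live r = proj₁ (proj₂ (positionOf-live r))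

  slotAt-< : ∀ r → slotAt r < width (gateAt r)
  slotAt-< r = proj₂ (proj₂ (positionOf-live r))

  width-junction : ∀ {v} → ¬ IsInputLabel (label P v) → nonConstant v ≡ true → width v ≡ length (essential v)
  width-junction {v} ¬input nc = ℕ.suc-pred _ {{>-nonZero (essential-nonempty (junction _ ¬input) v refl nc)}}

  record Child (r : Gate′) : Set where
    field
      child          : Gate P
      child-at       : lookup? (essential (gateAt r)) (slotAt r) ≡ just child
      child-live     : live child ≡ true
      childGate      : Gate′
      childGate-top  : positionOf childGate ≡ top child
      childGate-wire : (childGate , r) ∈ wires′
  open Child

  childOf : ∀ r → ¬ IsInputLabel (label′ r) → Child r
  childOf r ¬input = record
    { child = c ; child-at = c-at ; child-live = c-live ; childGate = proj₁ cg ; childGate-top = proj₂ cg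
    ; childGate-wire = ∈-wires′⁺ (positionOf-live r , inj₂ (trans (cong (Maybe.map top) c-at) (cong just (sym (proj₂ cg))))) }
    where
    found : ∃ λ c → lookup? (essential (gateAt r)) (slotAt r) ≡ just c
    found = <⇒lookup? (essential (gateAt r))
              (subst (slotAt r <_) (width-junction ¬input (live⇒nonConstant (gateAt-live r))) (slotAt-< r))
    c = proj₁ found
    c-at = proj₂ found
    c-live = essential-live (gateAt-live r) (lookup?-∈ _ c-at)
    cg = positionOf-surjective (livePosition-top c-live)

  input-source′ : ∀ r → IsInputLabel (label′ r) → ∀ u → (u , r) ∉ wires′
  input-source′ r input u w∈ with ∈-wires′⁻ w∈ | essential-of-input input | slotAt-< r
  ... | _ , inj₁ (_ , 0<slot) | ess≡[] | slot<width =
          ℕ.<-irrefl refl (ℕ.<-≤-trans 0<slot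
            (ℕ.≤-pred (subst (λ xs → slotAt r < suc (pred (length xs))) ess≡[] slot<width)))
  ... | _ , inj₂ e | ess≡[] | _ with childTop⁻ {positionOf r} e
  ... | c , c-at , _ with subst (λ xs → lookup? xs (slotAt r) ≡ just c) ess≡[] c-at
  ... | ()

  noninput-wired′ : ∀ r → ¬ IsInputLabel (label′ r) → ∃ λ u → (u , r) ∈ wires′
  noninput-wired′ r ¬input = childGate C , childGate-wire C
    where C = childOf r ¬input

  essential-index<width : ∀ {w i u} → lookup? (essential w) i ≡ just u → i < width w
  essential-index<width {w} u-at = ℕ.≤-trans (lookup?-< (essential w) u-at) (length≤width w)

  essential-index<stride : ∀ {w i u} → lookup? (essential w) i ≡ just u → i < stride
  essential-index<stride {w} u-at = ℕ.≤-trans (essential-index<width u-at) (width≤stride w)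

  next-slot-wire : ∀ r → suc (slotAt r) < width (gateAt r) → ∃ λ s → (r , s) ∈ wires′
  next-slot-wire r next<width = proj₁ found , ∈-wires′⁺ (subst LivePosition (sym s↦) next-live , inj₁ (chain , 0<slot))
    where
    next-live = livePosition (gateAt-live r) next<width
    found = positionOf-surjective next-live
    s↦ = proj₂ found
    chain : suc (positionOf r) ≡ positionOf (proj₁ found)
    chain = trans (cong suc (positionOf-decode r)) (trans (sym (position-suc (gateAt r) (slotAt r))) (sym s↦))
    0<slot : 0 < slotOf (positionOf (proj₁ found))
    0<slot = subst (0 <_) (sym (trans (cong slotOf s↦)
               (proj₂ (decode-position (gateAt r) (ℕ.≤-trans next<width (width≤stride _)))))) (s≤s z≤n)

  successor-gate-wire : ∀ r → positionOf r ≡ top (gateAt r) → gateAt r ≢ output P → ∃ λ s → (r , s) ∈ wires′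
  successor-gate-wire r r-top gate≢out =
    proj₁ found , ∈-wires′⁺ (subst LivePosition (sym (proj₂ found)) slot-live , inj₂ child-wire)
    where
    successor = live-successor (gateAt-live r) gate≢out
    w = proj₁ successor
    indexed = ∈⇒lookup? (∈-essential⁺ (proj₁ (proj₂ successor)) (live⇒nonConstant (gateAt-live r)))
    r-at = proj₂ indexed
    slot-live = livePosition (proj₂ (proj₂ successor)) (essential-index<width r-at)
    found = positionOf-surjective slot-live
    child-wire : childTop (positionOf (proj₁ found)) ≡ just (positionOf r)
    child-wire = trans (cong childTop (proj₂ found)) (trans (childTop-position w (essential-index<stride r-at))
                   (trans (cong (Maybe.map top) r-at) (cong just (sym r-top))))

  last-slot-top : ∀ r → ¬ suc (slotAt r) < width (gateAt r) → positionOf r ≡ top (gateAt r)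
  last-slot-top r next≮width = trans (positionOf-decode r) (cong (position (gateAt r))
    (ℕ.≤-antisym (ℕ.≤-pred (slotAt-< r)) (ℕ.≤-pred (ℕ.≮⇒≥ next≮width))))

  unique-sink′ : ∀ r → r ≢ fromℕ lastIndex → ∃ λ s → (r , s) ∈ wires′
  unique-sink′ r r≢last with suc (slotAt r) ℕ.<? width (gateAt r)
  ... | yes next<width = next-slot-wire r next<width
  ... | no next≮width with gateAt r ≟ output P
  ... | yes gate≡out = ⊥-elim (r≢last (positionOf-injective
                         (trans (last-slot-top r next≮width) (trans (cong top gate≡out) (sym positionOf-last)))))
  ... | no gate≢out = successor-gate-wire r (last-slot-top r next≮width) gate≢out

  D′ : NNF
  D′ = record
    { n              = lastIndex
    ; label          = label′
    ; wires          = wires′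
    ; wires-unique   = wires′-unique
    ; wires-topo     = All.tabulate λ w∈ → positionOf-reflects-< (Wire-< (∈-wires′⁻ w∈))
    ; input-source   = input-source′
    ; noninput-wired = noninput-wired′
    ; unique-sink    = unique-sink′
    }

  -- D′ computes the function of P

  data SlotView (r : Gate′) : Set where
    first-slot : slotAt r ≡ 0 → SlotView r
    later-slot : ∀ {j} (previous : Gate′) → slotAt r ≡ suc j →
                 positionOf previous ≡ position (gateAt r) j → SlotView r

  slotView : ∀ r → SlotView r
  slotView r = view (slotAt r) refl
    where
    view : ∀ j → slotAt r ≡ j → SlotView r
    view zero    slot≡ = first-slot slot≡
    view (suc j) slot≡ = later-slot (proj₁ found) slot≡ (proj₂ found)
      where
      j<width : j < width (gateAt r)
      j<width = ℕ.<-trans (ℕ.n<1+n j) (subst (_< width (gateAt r)) slot≡ (slotAt-< r))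
      found = positionOf-surjective (livePosition (gateAt-live r) j<width)

  inputsOf : ∀ {r} → Child r → SlotView r → List Gate′
  inputsOf C (first-slot _)            = childGate C ∷ []
  inputsOf C (later-slot previous _ _) = previous ∷ childGate C ∷ []

  positionOf-later : ∀ r {j} → slotAt r ≡ suc j → positionOf r ≡ suc (position (gateAt r) j)
  positionOf-later r {j} slot≡ = trans (positionOf-decode r)
    (trans (cong (position (gateAt r)) slot≡) (position-suc (gateAt r) j))

  previous-wire : ∀ r {j} (previous : Gate′) → slotAt r ≡ suc j →
                  positionOf previous ≡ position (gateAt r) j → (previous , r) ∈ wires′
  previous-wire r previous slot≡ previous↦ = ∈-wires′⁺ (positionOf-live r ,
    inj₁ (trans (cong suc previous↦) (sym (positionOf-later r slot≡)) , subst (0 <_) (sym slot≡) (s≤s z≤n)))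

  child-wire-source : ∀ {r u} (C : Child r) → childTop (positionOf r) ≡ just (positionOf u) → u ≡ childGate C
  child-wire-source {r} {u} C e with childTop⁻ {positionOf r} e
  ... | c , c-at , u↦top = positionOf-injective (trans u↦top (trans
          (cong top (just-injective (trans (sym c-at) (child-at C)))) (sym (childGate-top C))))

  inputsOf⇒wire : ∀ {r u} (C : Child r) (view : SlotView r) → u ∈ inputsOf C view → (u , r) ∈ wires′
  inputsOf⇒wire C (first-slot _)                        (here refl)         = childGate-wire C
  inputsOf⇒wire C (later-slot previous slot≡ previous↦) (here refl)         = previous-wire _ previous slot≡ previous↦
  inputsOf⇒wire C (later-slot _ _ _)                    (there (here refl)) = childGate-wire C

  wire⇒inputsOf : ∀ {r u} (C : Child r) (view : SlotView r) → (u , r) ∈ wires′ → u ∈ inputsOf C view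
  wire⇒inputsOf {r} {u} C view u→r with ∈-wires′⁻ u→r | view
  ... | _ , inj₂ e | first-slot _     = here (child-wire-source C e)
  ... | _ , inj₂ e | later-slot _ _ _ = there (here (child-wire-source C e))
  ... | _ , inj₁ (_ , 0<slot) | first-slot slot≡0 = ⊥-elim (ℕ.<-irrefl (sym slot≡0) 0<slot)
  ... | _ , inj₁ (chain , _) | later-slot previous slot≡ previous↦ = here (positionOf-injective
          (ℕ.suc-injective (trans chain (trans (positionOf-later r slot≡) (cong suc (sym previous↦))))))

  prefixValue : Assignment → Gate P → ℕ → Bool
  prefixValue a v j with label P v
  ... | and     = all (val a) (take (suc j) (essential v))
  ... | or      = any (val a) (take (suc j) (essential v))
  ... | pos x   = a x
  ... | const _ = false   -- constants and negative literals never label a live gate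
  ... | neg _   = false

  prefixValue-junction : ∀ {l} (J : Junction l) {a v j} → label P v ≡ l →
                         prefixValue a v j ≡ fold J (val a) (take (suc j) (essential v))
  prefixValue-junction ∧-gate lv rewrite lv = refl
  prefixValue-junction ∨-gate lv rewrite lv = refl

  prefixValue-pos : ∀ {a v j x} → label P v ≡ pos x → prefixValue a v j ≡ a x
  prefixValue-pos lv rewrite lv = refl

  prefixValue-top-junction : ∀ {l} (J : Junction l) a {v} → label P v ≡ l → live v ≡ true →
                             prefixValue a v (pred (length (essential v))) ≡ val a v
  prefixValue-top-junction J a {v} lab lv = begin
    prefixValue a v (pred (length (essential v)))   ≡⟨ prefixValue-junction J lab ⟩
    fold J (val a) (take (width v) (essential v))   ≡⟨ cong (fold J (val a)) (take-all (width v) (essential v) (length≤width v)) ⟩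
    fold J (val a) (essential v)                    ≡⟨ val-essential J a v lab (live⇒nonConstant lv) ⟨
    val a v                                         ∎
    where open ≡-Reasoning

  prefixValue-top : ∀ a {v} → live v ≡ true → prefixValue a v (pred (length (essential v))) ≡ val a v
  prefixValue-top a {v} lv = by-label (label P v) refl
    where
    by-label : ∀ l → label P v ≡ l → prefixValue a v (pred (length (essential v))) ≡ val a v
    by-label (pos x)   lab = trans (prefixValue-pos lab) (sym (trans (val-fixpoint a v) (gateValue-pos a (val a) v lab)))
    by-label (const b) lab = ⊥-elim (nonConstant-¬const (live⇒nonConstant lv) lab)
    by-label (neg x)   lab = ⊥-elim (noNeg v x lab)
    by-label and       lab = prefixValue-top-junction ∧-gate a lab lv
    by-label or        lab = prefixValue-top-junction ∨-gate a lab lv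

  valueAt : Assignment → Gate′ → Bool
  valueAt a r = prefixValue a (gateAt r) (slotAt r)

  valueAt-position : ∀ a {u v j} → j < stride → positionOf u ≡ position v j → valueAt a u ≡ prefixValue a v j
  valueAt-position a {u} {v} j< u↦ = cong₂ (prefixValue a) (proj₁ same) (proj₂ same)
    where same = gateAt-slotAt {u} {v} j< u↦

  valueAt-childGate : ∀ a {r} (C : Child r) → valueAt a (childGate C) ≡ val a (child C)
  valueAt-childGate a C = trans (valueAt-position a (width≤stride (child C)) (childGate-top C))
                                (prefixValue-top a (child-live C))

  fold-prefix : ∀ {l} (J : Junction l) a {r} (C : Child r) (view : SlotView r) → label′ r ≡ l →
                fold J (val a) (take (suc (slotAt r)) (essential (gateAt r))) ≡ fold J (valueAt a) (inputsOf C view)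
  fold-prefix J a {r} C (first-slot slot≡0) _ = begin
    fold J (val a) (take (suc (slotAt r)) ess)     ≡⟨ cong (fold J (val a)) (take-suc-lookup? ess (child-at C)) ⟩
    fold J (val a) (take (slotAt r) ess ++ child C ∷ [])
                                                   ≡⟨ cong (λ j → fold J (val a) (take j ess ++ child C ∷ [])) slot≡0 ⟩
    fold J (val a) (child C ∷ [])                  ≡⟨ fold-singleton-cong J (valueAt-childGate a C) ⟨
    fold J (valueAt a) (childGate C ∷ [])          ∎
    where
    open ≡-Reasoning
    ess = essential (gateAt r)
  fold-prefix J a {r} C (later-slot {j} previous slot≡ previous↦) lab = begin
    fold J (val a) (take (suc (slotAt r)) ess)     ≡⟨ cong (fold J (val a)) (take-suc-lookup? ess (child-at C)) ⟩
    fold J (val a) (take (slotAt r) ess ++ child C ∷ [])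
                                                   ≡⟨ fold-++ J (val a) _ _ ⟩
    combine J (fold J (val a) (take (slotAt r) ess)) (fold J (val a) (child C ∷ []))
                                                   ≡⟨ cong₂ (combine J) previous-value (fold-singleton-cong J (valueAt-childGate a C)) ⟨
    combine J (valueAt a previous) (fold J (valueAt a) (childGate C ∷ []))
                                                   ≡⟨ fold-∷ J (valueAt a) previous _ ⟨
    fold J (valueAt a) (previous ∷ childGate C ∷ []) ∎
    where
    open ≡-Reasoning
    ess = essential (gateAt r)
    j<stride : j < stride
    j<stride = ℕ.<-trans (ℕ.n<1+n j) (subst (_< stride) slot≡ (slotOf-< (positionOf r)))
    previous-value : valueAt a previous ≡ fold J (val a) (take (slotAt r) ess)
    previous-value = begin
      valueAt a previous                       ≡⟨ valueAt-position a j<stride previous↦ ⟩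
      prefixValue a (gateAt r) j               ≡⟨ prefixValue-junction J lab ⟩
      fold J (val a) (take (suc j) ess)        ≡⟨ cong (λ i → fold J (val a) (take i ess)) slot≡ ⟨
      fold J (val a) (take (slotAt r) ess)     ∎

  module D′ = Semantics D′

  valueAt-junction : ∀ {l} (J : Junction l) a r → label′ r ≡ l →
                     valueAt a r ≡ D′.gateValue a (valueAt a) r
  valueAt-junction J a r lab = begin
    valueAt a r                                                    ≡⟨ prefixValue-junction J lab ⟩
    fold J (val a) (take (suc (slotAt r)) (essential (gateAt r)))  ≡⟨ fold-prefix J a C view lab ⟩
    fold J (valueAt a) (inputsOf C view)                           ≡⟨ fold-same-members J (valueAt a) inputs⊆preds preds⊆inputs ⟩
    fold J (valueAt a) (preds D′ r)                                ≡⟨ D′.gateValue-junction J a (valueAt a) r lab ⟨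
    D′.gateValue a (valueAt a) r                                   ∎
    where
    open ≡-Reasoning
    C : Child r
    C = childOf r (subst (λ l → ¬ IsInputLabel l) (sym lab) (Junction⇒¬input J))
    view : SlotView r
    view = slotView r
    inputs⊆preds : ∀ {u} → u ∈ inputsOf C view → u ∈ preds D′ r
    inputs⊆preds u∈ = D′.∈-preds⁺ (inputsOf⇒wire C view u∈)
    preds⊆inputs : ∀ {u} → u ∈ preds D′ r → u ∈ inputsOf C view
    preds⊆inputs u∈ = wire⇒inputsOf C view (D′.∈-preds⁻ u∈)

  valueAt-fixpoint : ∀ a r → valueAt a r ≡ D′.gateValue a (valueAt a) r
  valueAt-fixpoint a r = by-label (label′ r) refl
    where
    by-label : ∀ l → label′ r ≡ l → valueAt a r ≡ D′.gateValue a (valueAt a) r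
    by-label (pos x)   lab = trans (prefixValue-pos lab) (sym (D′.gateValue-pos a (valueAt a) r lab))
    by-label (const b) lab = ⊥-elim (nonConstant-¬const (live⇒nonConstant (gateAt-live r)) lab)
    by-label (neg x)   lab = ⊥-elim (noNeg (gateAt r) x lab)
    by-label and       lab = valueAt-junction ∧-gate a r lab
    by-label or        lab = valueAt-junction ∨-gate a r lab

  D′-equivalent : Equivalent D′ P
  D′-equivalent a = begin
    eval D′ a                                                       ≡⟨ D′.eval≡val-output a ⟩
    D′.val a (fromℕ lastIndex)                                      ≡⟨ D′.fixpoint-unique a (valueAt a) (valueAt-fixpoint a) _ ⟨
    valueAt a (fromℕ lastIndex)                                     ≡⟨ valueAt-position a (width≤stride (output P)) positionOf-last ⟩
    prefixValue a (output P) (pred (length (essential (output P)))) ≡⟨ prefixValue-top a live-output ⟩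
    val a (output P)                                                ≡⟨ eval≡val-output a ⟨
    eval P a                                                        ∎
    where open ≡-Reasoning

  -- D′ is a nice DNNF with at most twice as many wires

  PrefixVar : Gate′ → Var → Set
  PrefixVar u x = label′ u ≡ pos x ⊎
                  ∃ λ i → i ≤ slotAt u × ∃ λ c → lookup? (essential (gateAt u)) i ≡ just c × InVarsSub P c x

  PrefixVar⇒InVarsSub : ∀ {u x} → PrefixVar u x → InVarsSub P (gateAt u) x
  PrefixVar⇒InVarsSub {u} (inj₁ lab) = gateAt u , here , inj₁ lab
  PrefixVar⇒InVarsSub {u} (inj₂ (i , _ , c , c-at , x∈c)) =
    InVarsSub-wire (proj₁ (∈-essential⁻ (lookup?-∈ (essential (gateAt u)) c-at))) x∈c

  PrefixVar-wire : ∀ {u w x} → (u , w) ∈ wires′ → PrefixVar u x → PrefixVar w x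
  PrefixVar-wire {u} {w} {x} u→w x∈u with ∈-wires′⁻ u→w
  ... | _ , inj₂ e = through-child (childTop⁻ {positionOf w} e)
    where
    through-child : (∃ λ c → lookup? (essential (gateAt w)) (slotAt w) ≡ just c × positionOf u ≡ top c) → PrefixVar w x
    through-child (c , c-at , u↦top) = inj₂ (slotAt w , ℕ.≤-refl , c , c-at ,
      subst (λ v → InVarsSub P v x) (proj₁ (gateAt-slotAt (width≤stride c) u↦top)) (PrefixVar⇒InVarsSub x∈u))
  ... | _ , inj₁ (chain , 0<slot) = through-chain (slotAt w) refl 0<slot
    where
    through-chain : ∀ s → slotAt w ≡ s → 0 < s → PrefixVar w x
    through-chain (suc j) slot≡ _ = move x∈u
      where
      same = gateAt-slotAt {u} (ℕ.<-trans (ℕ.n<1+n j) (subst (_< stride) slot≡ (slotOf-< (positionOf w))))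
                               (ℕ.suc-injective (trans chain (positionOf-later w slot≡)))
      gate≡ = proj₁ same
      move : PrefixVar u x → PrefixVar w x
      move (inj₁ lab) = inj₁ (trans (cong (label P) (sym gate≡)) lab)
      move (inj₂ (i , i≤ , c , c-at , x∈c)) =
        inj₂ (i , ℕ.≤-trans i≤ (ℕ.≤-trans (ℕ.≤-reflexive (proj₂ same)) (subst (j ≤_) (sym slot≡) (ℕ.n≤1+n j))) ,
              c , subst (λ v → lookup? (essential v) i ≡ just c) gate≡ c-at , x∈c)

  InVarsSub′⇒PrefixVar : ∀ {r x} → InVarsSub D′ r x → PrefixVar r x
  InVarsSub′⇒PrefixVar {x = x} (u , u↝r , inj₁ lab) = along u↝r (inj₁ lab)
    where
    along : ∀ {u r} → Reach D′ u r → PrefixVar u x → PrefixVar r x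
    along here          x∈u = x∈u
    along (step u→w w↝r) x∈u = along w↝r (PrefixVar-wire u→w x∈u)
  InVarsSub′⇒PrefixVar {x = x} (u , _ , inj₂ lab) = ⊥-elim (noNeg (gateAt u) x lab)

  childGate-vars : ∀ {r x} (C : Child r) → InVarsSub D′ (childGate C) x → InVarsSub P (child C) x
  childGate-vars {x = x} C x∈ = subst (λ v → InVarsSub P v x)
    (proj₁ (gateAt-slotAt (width≤stride (child C)) (childGate-top C))) (PrefixVar⇒InVarsSub (InVarsSub′⇒PrefixVar x∈))

  previous-vars : ∀ {r j x} (previous : Gate′) → label′ r ≡ and → slotAt r ≡ suc j →
                  positionOf previous ≡ position (gateAt r) j → InVarsSub D′ previous x →
                  ∃ λ i → i ≤ j × ∃ λ c → lookup? (essential (gateAt r)) i ≡ just c × InVarsSub P c x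
  previous-vars {r} {j} {x} previous lab slot≡ previous↦ x∈ = move (InVarsSub′⇒PrefixVar x∈)
    where
    same = gateAt-slotAt {previous} (ℕ.<-trans (ℕ.n<1+n j) (subst (_< stride) slot≡ (slotOf-< (positionOf r)))) previous↦
    move : PrefixVar previous x → ∃ λ i → i ≤ j × ∃ λ c → lookup? (essential (gateAt r)) i ≡ just c × InVarsSub P c x
    move (inj₁ lab′) = ⊥-elim (and≢pos (trans (sym lab) (trans (cong (label P) (sym (proj₁ same))) lab′)))
      where
      and≢pos : and ≢ pos x
      and≢pos ()
    move (inj₂ (i , i≤ , c , c-at , x∈c)) =
      i , ℕ.≤-trans i≤ (ℕ.≤-reflexive (proj₂ same)) ,
      c , subst (λ v → lookup? (essential v) i ≡ just c) (proj₁ same) c-at , x∈c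

  -- the inputs of a later ∧-slot carry the variables of earlier essential inputs and of the next one, which
  -- decomposability of P separates
  chain-child-disjoint : ∀ {r j x} (C : Child r) (previous : Gate′) → label′ r ≡ and → slotAt r ≡ suc j →
                         positionOf previous ≡ position (gateAt r) j →
                         InVarsSub D′ previous x → InVarsSub D′ (childGate C) x → ⊥
  chain-child-disjoint {r} {j} {x} C previous lab slot≡ previous↦ x∈previous x∈child =
    dnnf (gateAt r) lab (child C) c (essential-wire (child-at C)) (essential-wire c-at) child≢c x (childGate-vars C x∈child) x∈c
    where
    found = previous-vars previous lab slot≡ previous↦ x∈previous
    i = proj₁ found
    c = proj₁ (proj₂ (proj₂ found))
    c-at = proj₁ (proj₂ (proj₂ (proj₂ found)))
    x∈c = proj₂ (proj₂ (proj₂ (proj₂ found)))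
    essential-wire : ∀ {k u} → lookup? (essential (gateAt r)) k ≡ just u → (u , gateAt r) ∈ wires P
    essential-wire u-at = proj₁ (∈-essential⁻ (lookup?-∈ (essential (gateAt r)) u-at))
    child≢c : child C ≢ c
    child≢c child≡c = ℕ.<-irrefl
      (lookup?-injective (essential-unique (gateAt r)) c-at
        (trans (cong (lookup? (essential (gateAt r))) (sym slot≡)) (trans (child-at C) (cong just child≡c))))
      (s≤s (proj₁ (proj₂ found)))

  inputs-disjoint : ∀ {r u₁ u₂ x} → label′ r ≡ and → (C : Child r) (view : SlotView r) →
                    u₁ ∈ inputsOf C view → u₂ ∈ inputsOf C view → u₁ ≢ u₂ →
                    InVarsSub D′ u₁ x → InVarsSub D′ u₂ x → ⊥
  inputs-disjoint lab C (first-slot _) (here refl) (here refl) u₁≢u₂ _ _ = u₁≢u₂ refl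
  inputs-disjoint lab C (later-slot _ _ _) (here refl) (here refl) u₁≢u₂ _ _ = u₁≢u₂ refl
  inputs-disjoint lab C (later-slot _ _ _) (there (here refl)) (there (here refl)) u₁≢u₂ _ _ = u₁≢u₂ refl
  inputs-disjoint lab C (later-slot previous slot≡ previous↦) (here refl) (there (here refl)) _ x∈u₁ x∈u₂ =
    chain-child-disjoint C previous lab slot≡ previous↦ x∈u₁ x∈u₂
  inputs-disjoint lab C (later-slot previous slot≡ previous↦) (there (here refl)) (here refl) _ x∈u₁ x∈u₂ =
    chain-child-disjoint C previous lab slot≡ previous↦ x∈u₂ x∈u₁

  D′-isDNNF : IsDNNF D′
  D′-isDNNF r lab u₁ u₂ u₁→r u₂→r u₁≢u₂ x =
    inputs-disjoint lab C (slotView r) (wire⇒inputsOf C (slotView r) u₁→r) (wire⇒inputsOf C (slotView r) u₂→r) u₁≢u₂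
    where
    C : Child r
    C = childOf r (subst (λ l → ¬ IsInputLabel l) (sym lab) (Junction⇒¬input ∧-gate))

  inputsOf-length : ∀ {r} (C : Child r) (view : SlotView r) → length (inputsOf C view) ≤ 2
  inputsOf-length C (first-slot _)     = s≤s z≤n
  inputsOf-length C (later-slot _ _ _) = ℕ.≤-refl

  fanin′ : ∀ r → fanin D′ r ≤ 2
  fanin′ r = by-kind (isInput? (label′ r))
    where
    by-kind : Dec (IsInputLabel (label′ r)) → fanin D′ r ≤ 2
    by-kind (yes input) = ℕ.≤-trans (Unique⇒length≤ {ys = []} (D′.preds-unique r)
                            (λ u∈ → ⊥-elim (input-source′ r input _ (D′.∈-preds⁻ u∈)))) (z≤n {n = 2})
    by-kind (no ¬input) = ℕ.≤-trans (Unique⇒length≤ (D′.preds-unique r)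
                            (λ u∈ → wire⇒inputsOf C (slotView r) (D′.∈-preds⁻ u∈))) (inputsOf-length C (slotView r))
      where
      C : Child r
      C = childOf r ¬input

  D′-isNice : IsNice D′
  D′-isNice = D′-isDNNF , fanin′ , (λ r _ → nonConstant-¬const (live⇒nonConstant (gateAt-live r))) , (λ r → noNeg (gateAt r))

  -- a wire into r is either the chain wire from the previous slot or the wire from the child's last slot;
  -- within each kind r determines the wire, and r is determined by the P-wire (child, gate) it copies
  -- (childOrSelf falls back to the gate only at input gates, which receive no wires)
  childOrSelf : Gate′ → Gate P
  childOrSelf r = Maybe.fromMaybe (gateAt r) (lookup? (essential (gateAt r)) (slotAt r))

  wireImage : Gate′ × Gate′ → Gate P × Gate P
  wireImage (_ , r) = childOrSelf r , gateAt r

  childOf-wire : ∀ {u r} → (u , r) ∈ wires′ → Child r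
  childOf-wire {u} {r} u→r = childOf r (λ input → input-source′ r input u u→r)

  childOrSelf-child : ∀ {u r} (u→r : (u , r) ∈ wires′) → childOrSelf r ≡ child (childOf-wire u→r)
  childOrSelf-child u→r = cong (Maybe.fromMaybe _) (child-at (childOf-wire u→r))

  wireImage-∈ : ∀ {w} → w ∈ wires′ → wireImage w ∈ wires P
  wireImage-∈ {u , r} u→r = subst (λ c → (c , gateAt r) ∈ wires P) (sym (childOrSelf-child u→r))
    (proj₁ (∈-essential⁻ (lookup?-∈ (essential (gateAt r)) (child-at (childOf-wire u→r)))))

  wireImage-target : ∀ {u r u′ r′} → (u , r) ∈ wires′ → (u′ , r′) ∈ wires′ →
                     wireImage (u , r) ≡ wireImage (u′ , r′) → r ≡ r′
  wireImage-target {u} {r} {u′} {r′} u→r u′→r′ e = positionOf-injective (begin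
    positionOf r                     ≡⟨ positionOf-decode r ⟩
    position (gateAt r) (slotAt r)   ≡⟨ cong₂ position gate≡ slot≡ ⟩
    position (gateAt r′) (slotAt r′) ≡⟨ positionOf-decode r′ ⟨
    positionOf r′                    ∎)
    where
    open ≡-Reasoning
    gate≡ : gateAt r ≡ gateAt r′
    gate≡ = cong proj₂ e
    child≡ : child (childOf-wire u→r) ≡ child (childOf-wire u′→r′)
    child≡ = trans (sym (childOrSelf-child u→r)) (trans (cong proj₁ e) (childOrSelf-child u′→r′))
    slot≡ : slotAt r ≡ slotAt r′
    slot≡ = lookup?-injective (essential-unique (gateAt r)) (trans (child-at (childOf-wire u→r)) (cong just child≡))
              (subst (λ v → lookup? (essential v) (slotAt r′) ≡ just (child (childOf-wire u′→r′))) (sym gate≡)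
                     (child-at (childOf-wire u′→r′)))

  ChainWire : Gate′ × Gate′ → Set
  ChainWire (u , r) = suc (positionOf u) ≡ positionOf r × 0 < slotAt r

  chainWire? : ∀ w → Dec (ChainWire w)
  chainWire? (u , r) = (suc (positionOf u) ℕ.≟ positionOf r) ×-dec (0 ℕ.<? slotAt r)

  child-wire-from : ∀ {u r} (u→r : (u , r) ∈ wires′) → ¬ ChainWire (u , r) → u ≡ childGate (childOf-wire u→r)
  child-wire-from {u} {r} u→r ¬chain = by-kind (∈-wires′⁻ u→r)
    where
    by-kind : Wire (positionOf u) (positionOf r) → u ≡ childGate (childOf-wire u→r)
    by-kind (_ , inj₁ chain) = ⊥-elim (¬chain chain)
    by-kind (_ , inj₂ e)     = child-wire-source (childOf-wire u→r) e

  chain-wires-few : length (filter chainWire? wires′) ≤ size P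
  chain-wires-few = length≤-by-injection wireImage (Unique.filter⁺ chainWire? wires′-unique)
    (λ w∈ → wireImage-∈ (proj₁ (∈-filter⁻ chainWire? w∈))) injective
    where
    injective : ∀ {w w′} → w ∈ filter chainWire? wires′ → w′ ∈ filter chainWire? wires′ →
                wireImage w ≡ wireImage w′ → w ≡ w′
    injective {u , r} {u′ , r′} w∈ w′∈ e =
      cong₂ _,_ (positionOf-injective (ℕ.suc-injective (trans chain (trans (cong positionOf r≡r′) (sym chain′))))) r≡r′
      where
      u→r = ∈-filter⁻ chainWire? {xs = wires′} w∈
      u′→r′ = ∈-filter⁻ chainWire? {xs = wires′} w′∈
      r≡r′ = wireImage-target (proj₁ u→r) (proj₁ u′→r′) e
      chain = proj₁ (proj₂ u→r)
      chain′ = proj₁ (proj₂ u′→r′)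

  child-wires-few : length (filter (λ w → ¬? (chainWire? w)) wires′) ≤ size P
  child-wires-few = length≤-by-injection wireImage (Unique.filter⁺ (λ w → ¬? (chainWire? w)) wires′-unique)
    (λ w∈ → wireImage-∈ (proj₁ (∈-filter⁻ (λ w → ¬? (chainWire? w)) w∈))) injective
    where
    injective : ∀ {w w′} → w ∈ filter (λ w → ¬? (chainWire? w)) wires′ → w′ ∈ filter (λ w → ¬? (chainWire? w)) wires′ →
                wireImage w ≡ wireImage w′ → w ≡ w′
    injective {u , r} {u′ , r′} w∈ w′∈ e =
      same-target (wireImage-target (proj₁ u→r) (proj₁ u′→r′) e) (proj₁ u′→r′) (proj₂ u′→r′)
      where
      u→r = ∈-filter⁻ (λ w → ¬? (chainWire? w)) {xs = wires′} w∈
      u′→r′ = ∈-filter⁻ (λ w → ¬? (chainWire? w)) {xs = wires′} w′∈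
      same-target : ∀ {s} → r ≡ s → (u′→s : (u′ , s) ∈ wires′) → ¬ ChainWire (u′ , s) → (u , r) ≡ (u′ , s)
      same-target refl u′→r ¬chain′ =
        cong (_, r) (trans (child-wire-from (proj₁ u→r) (proj₂ u→r)) (sym (child-wire-from u′→r ¬chain′)))

  size-D′ : size D′ ≤ 2 * size P
  size-D′ = begin
    length wires′                                       ≡⟨ length-filter-∁ chainWire? wires′ ⟩
    length (filter chainWire? wires′) + length (filter (λ w → ¬? (chainWire? w)) wires′)
                                                        ≤⟨ ℕ.+-mono-≤ chain-wires-few child-wires-few ⟩
    size P + size P                                     ≡⟨ cong (size P +_) (ℕ.+-identityʳ (size P)) ⟨
    2 * size P                                          ∎
    where open ℕ.≤-Reasoning

-- Graph CNFs

module _ (G : Graph) where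

  graphCNF-monotone : ∀ a b → (∀ x → a x ≡ true → b x ≡ true) → evalGraphCNF G a ≡ true → evalGraphCNF G b ≡ true
  graphCNF-monotone a b a≤b = fold-mono ∧-gate (E G) λ {e} _ → ∨-mono (a≤b (proj₁ e)) (a≤b (proj₂ e))
    where
    ∨-mono : ∀ {p q p′ q′} → (p ≡ true → p′ ≡ true) → (q ≡ true → q′ ≡ true) → p ∨ q ≡ true → p′ ∨ q′ ≡ true
    ∨-mono {true}  p≤ _ _ rewrite p≤ refl = refl
    ∨-mono {false} {p′ = true}  _ _  _ = refl
    ∨-mono {false} {p′ = false} _ q≤ e = q≤ e

  graphCNF-allTrue : evalGraphCNF G allTrue ≡ true
  graphCNF-allTrue = all-true⁺ _ (E G) λ _ → refl

  graphCNF-allFalse : 0 < length (V G) → NoIsolated G → evalGraphCNF G allFalse ≡ false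
  graphCNF-allFalse 0<|V| noIsolated with V G | noIsolated
  ... | v ∷ _ | edge-at with edge-at v (here refl)
  ... | e , e∈ , _ = fold-absorbing ∧-gate _ e∈ refl

proposition5 : (G : Graph) → 2 ≤ length (V G) → NoIsolated G →
    (D : NNF) → IsDNNF D → EquivalentCNF D G →
    ∃ λ (D' : NNF) → IsNice D' × Equivalent D' D × size D' ≤ 2 * size D
proposition5 G 2≤|V| noIsolated D dnnf D≡G = D′ , D′-isNice , (λ a → trans (D′-equivalent a) (D⁺≡D a)) , size-D′
  where
  open PositivePart D
  D⁺≡D : Equivalent D⁺ D
  D⁺≡D = positivePart-equivalent dnnf λ a b a≤b e →
           trans (D≡G b) (graphCNF-monotone G a b a≤b (trans (sym (D≡G a)) e))
  D⁺-output : ∀ a → Semantics.val D⁺ a (output D⁺) ≡ evalGraphCNF G a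
  D⁺-output a = trans (sym (Semantics.eval≡val-output D⁺ a)) (trans (D⁺≡D a) (D≡G a))
  open Binarization D⁺ (positivePart-isDNNF dnnf) positivePart-noNeg
         (trans (D⁺-output allTrue) (graphCNF-allTrue G))
         (trans (D⁺-output allFalse) (graphCNF-allFalse G (ℕ.<⇒≤ 2≤|V|) noIsolated))
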